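{- Let $T$ be a primed tableau and $i\ge1$, $j=i+1$. If $e_i(T)\neq0$ then, with $y,p$ the positions chosen in the definition of $e_i$, either $p=y$, in which case $e_i(T)$ is obtained from $T$ by changing the $j$ in $y$ into $i$, or else $e_i(T)$ is obtained by changing the $j$ in $y$ into $j'$ and the $j'$ in $p$ into $i$. Moreover, $e_i(T)$ is a primed tableau.
   Context: Entries are ordered $1'<1<2'<2<3'<3<\cdots$; decreasing an entry "by a half unit" means replacing it by the previous entry ($i\mapsto i'$, $(i+1)'\mapsto i$). A primed tableau of shape $\lambda/\mu$ is a filling of the skew Young diagram (English convention) with such entries, rows and columns weakly increasing, each row containing at most one $i'$ for each $i$, and each column at most one unprimed $i$ for each $i$. For a position $p$, $c(p)$ is its entry; if $p$ is not a box of $T$ we take $c(p)=-\infty$ here. The reading word of $T$ consists of the unprimed entries read along rows left to right, from the bottom row to the top row; the $i$-$j$ subword keeps only letters $i,j$; bracketing pairs a $j$ with an $i$ to its right with all letters in between already paired ($j$ = opening, $i$ = closing parenthesis), repeatedly; unpaired letters are unbracketed. Operator $e_i$: if the $i$-$j$ subword has no unbracketed $j$, $e_i(T)=0$. Otherwise let $y$ be the position of the leftmost unbracketed $j$, $W_y$ the position immediately left of $y$, $N_y$ the position immediately above. Choose $p$: (1) if $c(W_y)\le i$ and $c(N_y)<i$, $p=y$; (2) if $c(W_y)=j'$, $p=W_y$; (3) if $c(W_y)\le i$ and $c(N_y)\in\{i,j'\}$, $p$ is the Northeast-most position of the maximal ribbon (connected skew shape with no $2\times2$ square) starting at $N_y$,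 extending North and/or East, containing only entries $i$ and $j'$. Then $e_i(T)$ is obtained by decreasing $c(y)$ by a half unit and then $c(p)$ by a half unit. -}

module Defs where

open import Data.Nat using (ℕ; zero; suc; _+_; _≤_; _<_; _≤ᵇ_; _<ᵇ_; _≡ᵇ_)
open import Data.Bool using (Bool; true; false; _∧_; _∨_; if_then_else_)
open import Data.List using (List; []; _∷_; length; reverse; _++_)
open import Data.Maybe using (Maybe; just; nothing)
open import Data.Product using (_×_; _,_)
open import Data.Empty using (⊥)
open import Relation.Binary.PropositionalEquality using (_≡_)
open import Relation.Nullary using (¬_)

-- Entries 1' < 1 < 2' < 2 < ...   (pr i = i', un i = i)

data Entry : Set where
  pr : ℕ → Entry
  un : ℕ → Entry

idx : Entry → ℕ
idx (pr i) = i
idx (un i) = i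

-- rank realising the total order  i' < i < (i+1)'
rank : Entry → ℕ
rank (pr i) = i + i
rank (un i) = suc (i + i)

eqE : Entry → Entry → Bool
eqE (pr a) (pr b) = a ≡ᵇ b
eqE (un a) (un b) = a ≡ᵇ b
eqE _ _ = false

-- decrease by a half unit: i ↦ i', (i+1)' ↦ i   (1' has no predecessor;
-- this case never occurs for the operator, junk value)
halfDown : Entry → Entry
halfDown (un i) = pr i
halfDown (pr zero) = pr zero
halfDown (pr (suc i)) = un i

-- Skew tableaux (English convention).  A tableau is a list of rows from
-- top (row 0) to bottom; a row is (μ_r , entries), the entries occupying
-- columns μ_r , μ_r + 1 , ... , μ_r + length - 1 .

Row : Set
Row = ℕ × List Entry

Tableau : Set
Tableau = List Row

-- position = (row , column), rows counted from the top, columns from the left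
Pos : Set
Pos = ℕ × ℕ

nth : {A : Set} → List A → ℕ → Maybe A
nth [] _ = nothing
nth (x ∷ xs) zero = just x
nth (x ∷ xs) (suc n) = nth xs n

updAt : {A : Set} → ℕ → (A → A) → List A → List A
updAt _ f [] = []
updAt zero f (x ∷ xs) = f x ∷ xs
updAt (suc n) f (x ∷ xs) = x ∷ updAt n f xs

rowEntry : ℕ → List Entry → ℕ → Maybe Entry
rowEntry zero w c = nth w c
rowEntry (suc o) w zero = nothing
rowEntry (suc o) w (suc c) = rowEntry o w c

rowModify : ℕ → List Entry → ℕ → (Entry → Entry) → List Entry
rowModify zero w c f = updAt c f w
rowModify (suc o) w zero f = w
rowModify (suc o) w (suc c) f = rowModify o w c f

-- c(p); nothing means p is not a box of T (i.e. c(p) = -∞)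
entryAt : Tableau → Pos → Maybe Entry
entryAt T (r , c) with nth T r
... | nothing = nothing
... | just (o , w) = rowEntry o w c

entryAtM : Tableau → Maybe Pos → Maybe Entry
entryAtM T nothing = nothing
entryAtM T (just p) = entryAt T p

modifyAt : Pos → (Entry → Entry) → Tableau → Tableau
modifyAt (r , c) f T = updAt r (λ { (o , w) → (o , rowModify o w c f) }) T

setAt : Pos → Entry → Tableau → Tableau
setAt p e T = modifyAt p (λ _ → e) T

size : Tableau → ℕ
size [] = zero
size ((o , w) ∷ T) = length w + size T

record IsPrimedTableau (T : Tableau) : Set where
  field
    -- skew shape λ/μ with λ, μ partitions: μ_r and λ_r = μ_r + length
    -- both weakly decrease from top to bottom
    shapeμ : ∀ r o w o' w' → nth T r ≡ just (o , w) → nth T (suc r) ≡ just (o' , w') →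
             o' ≤ o
    shapeλ : ∀ r o w o' w' → nth T r ≡ just (o , w) → nth T (suc r) ≡ just (o' , w') →
             o' + length w' ≤ o + length w
    entriesPos : ∀ p e → entryAt T p ≡ just e → 1 ≤ idx e
    rowWeak : ∀ r c e e' → entryAt T (r , c) ≡ just e → entryAt T (r , suc c) ≡ just e' →
              rank e ≤ rank e'
    colWeak : ∀ r c e e' → entryAt T (r , c) ≡ just e → entryAt T (suc r , c) ≡ just e' →
              rank e ≤ rank e'
    rowPrimed : ∀ r c c' k → c < c' → entryAt T (r , c) ≡ just (pr k) →
                entryAt T (r , c') ≡ just (pr k) → ⊥
    colUnprimed : ∀ r r' c k → r < r' → entryAt T (r , c) ≡ just (un k) →
                  entryAt T (r' , c) ≡ just (un k) → ⊥

-- Reading word: unprimed letters with their positions, rows read left to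
-- right, from the bottom row to the top row.

rowWord : ℕ → ℕ → List Entry → List (Pos × ℕ)
rowWord r c [] = []
rowWord r c (pr a ∷ w) = rowWord r (suc c) w
rowWord r c (un a ∷ w) = ((r , c) , a) ∷ rowWord r (suc c) w

readingWordFrom : ℕ → Tableau → List (Pos × ℕ)
readingWordFrom r [] = []
readingWordFrom r ((o , w) ∷ T) = readingWordFrom (suc r) T ++ rowWord r o w

readingWord : Tableau → List (Pos × ℕ)
readingWord T = readingWordFrom zero T

-- Bracketing of the i-(i+1) subword: scanning left to right, a j is pushed
-- on a stack; an i is paired with the most recent still unpaired j (if any).
-- The stack finally holds the unbracketed j's (most recent on top).
bracketScan : ℕ → List Pos → List (Pos × ℕ) → List Pos
bracketScan i st [] = st
bracketScan i st ((p , a) ∷ ws) =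
  if a ≡ᵇ suc i then bracketScan i (p ∷ st) ws
  else if a ≡ᵇ i then bracketScan i (pop st) ws
  else bracketScan i st ws
  where
    pop : List Pos → List Pos
    pop [] = []
    pop (_ ∷ s) = s

unbracketedJ : ℕ → Tableau → List Pos
unbracketedJ i T = reverse (bracketScan i [] (readingWord T))

leftmostUnbracketedJ : ℕ → Tableau → Maybe Pos
leftmostUnbracketedJ i T with unbracketedJ i T
... | [] = nothing
... | y ∷ _ = just y

westOf : Pos → Maybe Pos
westOf (r , zero) = nothing
westOf (r , suc c) = just (r , c)

northOf : Pos → Maybe Pos
northOf (zero , c) = nothing
northOf (suc r , c) = just (r , c)

eastOf : Pos → Pos
eastOf (r , c) = (r , suc c)

-- comparisons with -∞ = nothing
leM : Maybe Entry → Entry → Bool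
leM nothing x = true
leM (just e) x = rank e ≤ᵇ rank x

ltM : Maybe Entry → Entry → Bool
ltM nothing x = true
ltM (just e) x = rank e <ᵇ rank x

eqM : Maybe Entry → Entry → Bool
eqM nothing x = false
eqM (just e) x = eqE e x

inIJ' : ℕ → Maybe Entry → Bool
inIJ' i m = eqM m (un i) ∨ eqM m (pr (suc i))

-- Follow the ribbon of entries in {i, j'} North/East from q, returning its
-- Northeast-most box.  (In a primed tableau at most one of the North and
-- East neighbours of such a box is in {i, j'}.)  The fuel  size T  bounds
-- the length of any such path, so it never runs out.
ribbonEnd : ℕ → Tableau → ℕ → Pos → Pos
ribbonEnd i T zero q = q
ribbonEnd i T (suc n) q with northOf q
... | just q' with inIJ' i (entryAt T q')
...   | true = ribbonEnd i T n q'
...   | false = goEast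
  where
    goEast : Pos
    goEast = if inIJ' i (entryAt T (eastOf q)) then ribbonEnd i T n (eastOf q) else q
ribbonEnd i T (suc n) q | nothing =
  if inIJ' i (entryAt T (eastOf q)) then ribbonEnd i T n (eastOf q) else q

choiceP : ℕ → Tableau → Pos → Maybe Pos
choiceP i T y =
  if leM cW (un i) ∧ ltM cN (un i) then just y
  else if eqM cW (pr (suc i)) then westOf y
  else if leM cW (un i) ∧ inIJ' i cN then ribbon (northOf y)
  else nothing
  where
    cW = entryAtM T (westOf y)
    cN = entryAtM T (northOf y)
    ribbon : Maybe Pos → Maybe Pos
    ribbon nothing = nothing
    ribbon (just q) = just (ribbonEnd i T (size T) q)

-- result of applying e_i: zero (the 0 of the crystal), undefined (no case
-- of the definition applies), or a tableau
data ERes : Set where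
  zeroE : ERes
  undefE : ERes
  tabE : Tableau → ERes

eOp : ℕ → Tableau → ERes
eOp i T with leftmostUnbracketedJ i T
... | nothing = zeroE
... | just y with choiceP i T y
...   | nothing = undefE
...   | just p = tabE (modifyAt p halfDown (modifyAt y halfDown T))

module Submission where

-- Two consequences of y being the leftmost unbracketed j drive the proof:
-- the box West of y does not hold j, and every prefix of the word read after
-- y contains at least as many j's as i's.  This decides the three cases:
-- (1) c(W_y) ≤ i, c(N_y) < i gives p = y; (2) c(W_y) = j' gives p = W_y, whose
-- North neighbour is < i; (3) c(W_y) ≤ i, c(N_y) ∈ {i, j'}: a counting
-- invariant along the ribbon from N_y shows it ends at a j' above y whose
-- North neighbour is < i.  In each case the changed entries fit between
-- their neighbours, so primedness is preserved.

open import Defs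
open import Data.Nat using (ℕ; zero; suc; _+_; _∸_; _≤_; _<_; _≡ᵇ_; z≤n; s≤s; ⌊_/2⌋)
open import Data.Nat.Properties
open import Algebra.Properties.CommutativeSemigroup +-commutativeSemigroup using () renaming (xy∙z≈xz∙y to +-swapʳ)
open import Data.Bool using (true; false; if_then_else_)
open import Data.Bool.Properties using (T-≡; ¬-not; ∨-zeroʳ)
open import Function.Bundles using (Equivalence)
open import Data.List using (List; []; _∷_; length; reverse; _++_; drop; _∷ʳ_)
open import Data.List.Properties using (++-assoc; ++-identityʳ; reverse-++; unfold-reverse; drop-[]; length-++)
open import Data.List.Membership.Propositional using (_∈_)
open import Data.List.Membership.Propositional.Properties using (∈-++⁻; ∈-++⁺ˡ; ∈-++⁺ʳ)
open import Data.List.Relation.Unary.Any using (here; there)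
open import Data.List.Relation.Unary.Any.Properties using (reverse⁻)
open import Data.Maybe using (Maybe; just; nothing)
import Data.Maybe as M
open import Data.Maybe.Properties using (just-injective)
open import Data.Product using (Σ; _×_; _,_; proj₁; proj₂)
import Data.Product
open import Data.Product.Properties using (≡-dec)
open import Data.Sum using (_⊎_; inj₁; inj₂)
import Data.Sum
open import Data.Empty using (⊥; ⊥-elim)
open import Function using (_∘_)
open import Relation.Binary.PropositionalEquality
open import Relation.Nullary using (Dec; yes; no)
open import Relation.Binary.Definitions using (tri<; tri≈; tri>)

_≟P_ : (p q : Pos) → Dec (p ≡ q)
_≟P_ = ≡-dec _≟_ _≟_

nth-updAt-here : {A : Set} (xs : List A) (n : ℕ) (f : A → A) → nth (updAt n f xs) n ≡ M.map f (nth xs n)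
nth-updAt-here [] n f = refl
nth-updAt-here (x ∷ xs) zero f = refl
nth-updAt-here (x ∷ xs) (suc n) f = nth-updAt-here xs n f

nth-updAt-elsewhere : {A : Set} (xs : List A) (n m : ℕ) (f : A → A) → m ≢ n → nth (updAt n f xs) m ≡ nth xs m
nth-updAt-elsewhere [] n m f ne = refl
nth-updAt-elsewhere (x ∷ xs) zero zero f ne = ⊥-elim (ne refl)
nth-updAt-elsewhere (x ∷ xs) zero (suc m) f ne = refl
nth-updAt-elsewhere (x ∷ xs) (suc n) zero f ne = refl
nth-updAt-elsewhere (x ∷ xs) (suc n) (suc m) f ne = nth-updAt-elsewhere xs n m f (ne ∘ cong suc)

length-updAt : {A : Set} (xs : List A) (n : ℕ) (f : A → A) → length (updAt n f xs) ≡ length xs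
length-updAt [] n f = refl
length-updAt (x ∷ xs) zero f = refl
length-updAt (x ∷ xs) (suc n) f = cong suc (length-updAt xs n f)

updAt-∘ : {A : Set} (xs : List A) (n : ℕ) (g f : A → A) → updAt n g (updAt n f xs) ≡ updAt n (g ∘ f) xs
updAt-∘ [] n g f = refl
updAt-∘ (x ∷ xs) zero g f = refl
updAt-∘ (x ∷ xs) (suc n) g f = cong (x ∷_) (updAt-∘ xs n g f)

updAt-cong : {A : Set} (xs : List A) (n : ℕ) {f g : A → A} {x : A} →
  nth xs n ≡ just x → f x ≡ g x → updAt n f xs ≡ updAt n g xs
updAt-cong [] n e fg = refl
updAt-cong (y ∷ xs) zero refl fg = cong (_∷ xs) fg
updAt-cong (y ∷ xs) (suc n) e fg = cong (y ∷_) (updAt-cong xs n e fg)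

updAt-commute : {A : Set} (m n : ℕ) (f g : A → A) (xs : List A) →
  (m ≡ n → ∀ x → f (g x) ≡ g (f x)) → updAt m f (updAt n g xs) ≡ updAt n g (updAt m f xs)
updAt-commute m n f g [] h = refl
updAt-commute zero zero f g (x ∷ xs) h = cong (_∷ xs) (h refl x)
updAt-commute zero (suc n) f g (x ∷ xs) h = refl
updAt-commute (suc m) zero f g (x ∷ xs) h = refl
updAt-commute (suc m) (suc n) f g (x ∷ xs) h = cong (x ∷_) (updAt-commute m n f g xs (h ∘ cong suc))

rowEntry-rowModify-here : ∀ o w c f → rowEntry o (rowModify o w c f) c ≡ M.map f (rowEntry o w c)
rowEntry-rowModify-here zero w c f = nth-updAt-here w c f
rowEntry-rowModify-here (suc o) w zero f = refl
rowEntry-rowModify-here (suc o) w (suc c) f = rowEntry-rowModify-here o w c f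

rowEntry-rowModify-elsewhere : ∀ o w c c' f → c' ≢ c → rowEntry o (rowModify o w c f) c' ≡ rowEntry o w c'
rowEntry-rowModify-elsewhere zero w c c' f ne = nth-updAt-elsewhere w c c' f ne
rowEntry-rowModify-elsewhere (suc o) w zero c' f ne = refl
rowEntry-rowModify-elsewhere (suc o) w (suc c) zero f ne = refl
rowEntry-rowModify-elsewhere (suc o) w (suc c) (suc c') f ne =
  rowEntry-rowModify-elsewhere o w c c' f (ne ∘ cong suc)

length-rowModify : ∀ o w c f → length (rowModify o w c f) ≡ length w
length-rowModify zero w c f = length-updAt w c f
length-rowModify (suc o) w zero f = refl
length-rowModify (suc o) w (suc c) f = length-rowModify o w c f

rowModify-∘ : ∀ o w c g f → rowModify o (rowModify o w c f) c g ≡ rowModify o w c (g ∘ f)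
rowModify-∘ zero w c g f = updAt-∘ w c g f
rowModify-∘ (suc o) w zero g f = refl
rowModify-∘ (suc o) w (suc c) g f = rowModify-∘ o w c g f

rowModify-cong : ∀ o w c {f g : Entry → Entry} {e} → rowEntry o w c ≡ just e → f e ≡ g e →
  rowModify o w c f ≡ rowModify o w c g
rowModify-cong zero w c e fg = updAt-cong w c e fg
rowModify-cong (suc o) w zero e fg = refl
rowModify-cong (suc o) w (suc c) e fg = rowModify-cong o w c e fg

rowModify-commute : ∀ o w c c' f g → c ≢ c' →
  rowModify o (rowModify o w c' g) c f ≡ rowModify o (rowModify o w c f) c' g
rowModify-commute zero w c c' f g ne = updAt-commute c c' f g w (λ e → ⊥-elim (ne e))
rowModify-commute (suc o) w zero zero f g ne = ⊥-elim (ne refl)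
rowModify-commute (suc o) w zero (suc c') f g ne = refl
rowModify-commute (suc o) w (suc c) zero f g ne = refl
rowModify-commute (suc o) w (suc c) (suc c') f g ne = rowModify-commute o w c c' f g (ne ∘ cong suc)

modifyRow : ℕ → (Entry → Entry) → Row → Row
modifyRow c f (o , w) = o , rowModify o w c f

rowEntryM : Maybe Row → ℕ → Maybe Entry
rowEntryM nothing c = nothing
rowEntryM (just (o , w)) c = rowEntry o w c

entryAt-row : ∀ T r c → entryAt T (r , c) ≡ rowEntryM (nth T r) c
entryAt-row T r c with nth T r
... | nothing = refl
... | just _ = refl

rowEntryM-modify-here : ∀ m c f → rowEntryM (M.map (modifyRow c f) m) c ≡ M.map f (rowEntryM m c)
rowEntryM-modify-here nothing c f = refl
rowEntryM-modify-here (just (o , w)) c f = rowEntry-rowModify-here o w c f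

rowEntryM-modify-elsewhere : ∀ m c c' f → c' ≢ c → rowEntryM (M.map (modifyRow c f) m) c' ≡ rowEntryM m c'
rowEntryM-modify-elsewhere nothing c c' f ne = refl
rowEntryM-modify-elsewhere (just (o , w)) c c' f ne = rowEntry-rowModify-elsewhere o w c c' f ne

entryAt-modify-here : ∀ T q f → entryAt (modifyAt q f T) q ≡ M.map f (entryAt T q)
entryAt-modify-here T (r , c) f = begin
  entryAt (modifyAt (r , c) f T) (r , c)           ≡⟨ entryAt-row (modifyAt (r , c) f T) r c ⟩
  rowEntryM (nth (updAt r (modifyRow c f) T) r) c  ≡⟨ cong (λ m → rowEntryM m c) (nth-updAt-here T r (modifyRow c f)) ⟩
  rowEntryM (M.map (modifyRow c f) (nth T r)) c    ≡⟨ rowEntryM-modify-here (nth T r) c f ⟩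
  M.map f (rowEntryM (nth T r) c)                  ≡⟨ cong (M.map f) (sym (entryAt-row T r c)) ⟩
  M.map f (entryAt T (r , c))                      ∎
  where open ≡-Reasoning

entryAt-modify-elsewhere : ∀ T q f q' → q' ≢ q → entryAt (modifyAt q f T) q' ≡ entryAt T q'
entryAt-modify-elsewhere T (r , c) f (r' , c') ne with r' ≟ r
... | no r'≢r = trans (entryAt-row (modifyAt (r , c) f T) r' c')
  (trans (cong (λ m → rowEntryM m c') (nth-updAt-elsewhere T r r' (modifyRow c f) r'≢r)) (sym (entryAt-row T r' c')))
... | yes refl = trans (entryAt-row (modifyAt (r , c) f T) r c')
  (trans (cong (λ m → rowEntryM m c') (nth-updAt-here T r (modifyRow c f)))
  (trans (rowEntryM-modify-elsewhere (nth T r) c c' f (ne ∘ cong (r ,_))) (sym (entryAt-row T r c'))))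

rowShape : Row → ℕ × ℕ
rowShape (o , w) = o , length w

rowShape-modify : ∀ T q f r → M.map rowShape (nth (modifyAt q f T) r) ≡ M.map rowShape (nth T r)
rowShape-modify T (r₀ , c) f r with r ≟ r₀
... | no ne = cong (M.map rowShape) (nth-updAt-elsewhere T r₀ r (modifyRow c f) ne)
... | yes refl = trans (cong (M.map rowShape) (nth-updAt-here T r (modifyRow c f))) (shapeKept (nth T r))
  where
    shapeKept : ∀ m → M.map rowShape (M.map (modifyRow c f) m) ≡ M.map rowShape m
    shapeKept nothing = refl
    shapeKept (just (o , w)) = cong (λ n → just (o , n)) (length-rowModify o w c f)

entryAt-inRow : ∀ T r c {e} → entryAt T (r , c) ≡ just e →
  Σ ℕ (λ o → Σ (List Entry) (λ w → nth T r ≡ just (o , w) × rowEntry o w c ≡ just e))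
entryAt-inRow T r c eq with nth T r
... | just (o , w) = o , w , refl , eq

entryAt-fromRow : ∀ T r c {o w} → nth T r ≡ just (o , w) → entryAt T (r , c) ≡ rowEntry o w c
entryAt-fromRow T r c eq = trans (entryAt-row T r c) (cong (λ m → rowEntryM m c) eq)

modifyAt-cong : ∀ T q {f g : Entry → Entry} {e} → entryAt T q ≡ just e → f e ≡ g e →
  modifyAt q f T ≡ modifyAt q g T
modifyAt-cong T (r , c) hq fg with entryAt-inRow T r c hq
... | o , w , hr , hc = updAt-cong T r hr (cong (o ,_) (rowModify-cong o w c hc fg))

modifyAt-twice : ∀ T q (g f h : Entry → Entry) {e} → entryAt T q ≡ just e → g (f e) ≡ h e →
  modifyAt q g (modifyAt q f T) ≡ modifyAt q h T
modifyAt-twice T (r , c) g f h hq gfh with entryAt-inRow T r c hq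
... | o , w , hr , hc = trans (updAt-∘ T r (modifyRow c g) (modifyRow c f))
  (updAt-cong T r hr (cong (o ,_) (trans (rowModify-∘ o w c g f) (rowModify-cong o w c hc gfh))))

modifyAt-commute : ∀ T q q' f g → q ≢ q' → modifyAt q f (modifyAt q' g T) ≡ modifyAt q' g (modifyAt q f T)
modifyAt-commute T (r , c) (r' , c') f g ne = updAt-commute r r' (modifyRow c f) (modifyRow c' g) T commuteRow
  where
    commuteRow : r ≡ r' → ∀ x → modifyRow c f (modifyRow c' g x) ≡ modifyRow c' g (modifyRow c f x)
    commuteRow refl (o , w) = cong (o ,_) (rowModify-commute o w c c' f g (ne ∘ cong (r ,_)))

entryAt-set-here : ∀ T q {e} e' → entryAt T q ≡ just e → entryAt (setAt q e' T) q ≡ just e'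
entryAt-set-here T q e' hq = trans (entryAt-modify-here T q (λ _ → e')) (cong (M.map (λ _ → e')) hq)

entryAt-set-elsewhere : ∀ T q e' q' → q' ≢ q → entryAt (setAt q e' T) q' ≡ entryAt T q'
entryAt-set-elsewhere T q e' = entryAt-modify-elsewhere T q (λ _ → e')

rowBefore : ∀ T q f r {o w} → nth (modifyAt q f T) r ≡ just (o , w) →
  Σ (List Entry) (λ w₀ → nth T r ≡ just (o , w₀) × length w₀ ≡ length w)
rowBefore T q f r {o} {w} eq = unshape (nth T r) (trans (cong (M.map rowShape) (sym eq)) (rowShape-modify T q f r))
  where
    unshape : ∀ m {n} → just (o , n) ≡ M.map rowShape m → Σ (List Entry) (λ w₀ → m ≡ just (o , w₀) × length w₀ ≡ n)
    unshape (just (_ , w₀)) refl = w₀ , refl , refl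

AtWest : Tableau → Pos → (Entry → Set) → Set
AtWest T (r , c) P = ∀ c₀ x → c ≡ suc c₀ → entryAt T (r , c₀) ≡ just x → P x

AtNorth : Tableau → Pos → (Entry → Set) → Set
AtNorth T (r , c) P = ∀ r₀ x → r ≡ suc r₀ → entryAt T (r₀ , c) ≡ just x → P x

record Fits (T : Tableau) (r c : ℕ) (e' : Entry) : Set where
  field
    positive : 1 ≤ idx e'
    westBelow : AtWest T (r , c) (λ x → rank x ≤ rank e')
    eastAbove : ∀ x → entryAt T (r , suc c) ≡ just x → rank e' ≤ rank x
    northBelow : AtNorth T (r , c) (λ x → rank x ≤ rank e')
    southAbove : ∀ x → entryAt T (suc r , c) ≡ just x → rank e' ≤ rank x
    primedAlone : ∀ k → e' ≡ pr k → ∀ c' → c' ≢ c → entryAt T (r , c') ≢ just (pr k)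
    unprimedAlone : ∀ k → e' ≡ un k → ∀ r' → r' ≢ r → entryAt T (r' , c) ≢ just (un k)

modify-shapes : ∀ T q f → IsPrimedTableau T →
  (∀ r o w o' w' → nth (modifyAt q f T) r ≡ just (o , w) → nth (modifyAt q f T) (suc r) ≡ just (o' , w') → o' ≤ o) ×
  (∀ r o w o' w' → nth (modifyAt q f T) r ≡ just (o , w) → nth (modifyAt q f T) (suc r) ≡ just (o' , w') →
     o' + length w' ≤ o + length w)
modify-shapes T q f P = offsets , ends
  where
    open IsPrimedTableau P
    offsets : ∀ r o w o' w' → nth (modifyAt q f T) r ≡ just (o , w) → nth (modifyAt q f T) (suc r) ≡ just (o' , w') → o' ≤ o
    offsets r o w o' w' h h' = shapeμ r o _ o' _ (proj₁ (proj₂ (rowBefore T q f r h))) (proj₁ (proj₂ (rowBefore T q f (suc r) h')))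
    ends : ∀ r o w o' w' → nth (modifyAt q f T) r ≡ just (o , w) → nth (modifyAt q f T) (suc r) ≡ just (o' , w') →
      o' + length w' ≤ o + length w
    ends r o w o' w' h h' with rowBefore T q f r h | rowBefore T q f (suc r) h'
    ... | w₀ , h₀ , l₀ | w₀' , h₀' , l₀' = subst₂ (λ a b → o' + a ≤ o + b) l₀' l₀ (shapeλ r o w₀ o' w₀' h₀ h₀')

-- The entry conditions of U = setAt q e' T, for an entry e' that fits at q:
-- a condition involving q reduces to a field of Fits, any other to T.
module OneBoxChange (T : Tableau) (P : IsPrimedTableau T) (r c : ℕ) {e : Entry} (e' : Entry)
                    (hq : entryAt T (r , c) ≡ just e) (F : Fits T r c e') where
  open IsPrimedTableau P
  open Fits F

  q : Pos
  q = (r , c)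

  U : Tableau
  U = setAt q e' T

  atQ : ∀ {x} → entryAt U q ≡ just x → e' ≡ x
  atQ h = just-injective (trans (sym (entryAt-set-here T q e' hq)) h)

  away : ∀ {q' x} → q' ≢ q → entryAt U q' ≡ just x → entryAt T q' ≡ just x
  away {q'} ne h = trans (sym (entryAt-set-elsewhere T q e' q' ne)) h

  positives : ∀ p x → entryAt U p ≡ just x → 1 ≤ idx x
  positives p x h with p ≟P q
  ... | yes refl = subst (λ z → 1 ≤ idx z) (atQ h) positive
  ... | no ne = entriesPos p x (away ne h)

  rowsWeak : ∀ r₁ c₁ e₁ e₂ → entryAt U (r₁ , c₁) ≡ just e₁ → entryAt U (r₁ , suc c₁) ≡ just e₂ → rank e₁ ≤ rank e₂
  rowsWeak r₁ c₁ e₁ e₂ h₁ h₂ with (r₁ , c₁) ≟P q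
  ... | yes refl = subst (λ z → rank z ≤ rank e₂) (atQ h₁) (eastAbove e₂ (away (1+n≢n ∘ cong proj₂) h₂))
  ... | no ne₁ with (r₁ , suc c₁) ≟P q
  ...   | yes refl = subst (λ z → rank e₁ ≤ rank z) (atQ h₂) (westBelow c₁ e₁ refl (away ne₁ h₁))
  ...   | no ne₂ = rowWeak r₁ c₁ e₁ e₂ (away ne₁ h₁) (away ne₂ h₂)

  colsWeak : ∀ r₁ c₁ e₁ e₂ → entryAt U (r₁ , c₁) ≡ just e₁ → entryAt U (suc r₁ , c₁) ≡ just e₂ → rank e₁ ≤ rank e₂
  colsWeak r₁ c₁ e₁ e₂ h₁ h₂ with (r₁ , c₁) ≟P q
  ... | yes refl = subst (λ z → rank z ≤ rank e₂) (atQ h₁) (southAbove e₂ (away (1+n≢n ∘ cong proj₁) h₂))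
  ... | no ne₁ with (suc r₁ , c₁) ≟P q
  ...   | yes refl = subst (λ z → rank e₁ ≤ rank z) (atQ h₂) (northBelow r₁ e₁ refl (away ne₁ h₁))
  ...   | no ne₂ = colWeak r₁ c₁ e₁ e₂ (away ne₁ h₁) (away ne₂ h₂)

  rowsPrimed : ∀ r₁ c₁ c₂ k → c₁ < c₂ → entryAt U (r₁ , c₁) ≡ just (pr k) → entryAt U (r₁ , c₂) ≡ just (pr k) → ⊥
  rowsPrimed r₁ c₁ c₂ k lt h₁ h₂ with (r₁ , c₁) ≟P q
  ... | yes refl = primedAlone k (atQ h₁) c₂ (>⇒≢ lt) (away (>⇒≢ lt ∘ cong proj₂) h₂)
  ... | no ne₁ with (r₁ , c₂) ≟P q
  ...   | yes refl = primedAlone k (atQ h₂) c₁ (<⇒≢ lt) (away ne₁ h₁)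
  ...   | no ne₂ = rowPrimed r₁ c₁ c₂ k lt (away ne₁ h₁) (away ne₂ h₂)

  colsUnprimed : ∀ r₁ r₂ c₁ k → r₁ < r₂ → entryAt U (r₁ , c₁) ≡ just (un k) → entryAt U (r₂ , c₁) ≡ just (un k) → ⊥
  colsUnprimed r₁ r₂ c₁ k lt h₁ h₂ with (r₁ , c₁) ≟P q
  ... | yes refl = unprimedAlone k (atQ h₁) r₂ (>⇒≢ lt) (away (>⇒≢ lt ∘ cong proj₁) h₂)
  ... | no ne₁ with (r₂ , c₁) ≟P q
  ...   | yes refl = unprimedAlone k (atQ h₂) r₁ (<⇒≢ lt) (away ne₁ h₁)
  ...   | no ne₂ = colUnprimed r₁ r₂ c₁ k lt (away ne₁ h₁) (away ne₂ h₂)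

setAt-primed : ∀ T r c {e} e' → IsPrimedTableau T → entryAt T (r , c) ≡ just e → Fits T r c e' →
  IsPrimedTableau (setAt (r , c) e' T)
setAt-primed T r c e' P hq F = record
  { shapeμ = proj₁ (modify-shapes T (r , c) (λ _ → e') P)
  ; shapeλ = proj₂ (modify-shapes T (r , c) (λ _ → e') P)
  ; entriesPos = positives
  ; rowWeak = rowsWeak
  ; colWeak = colsWeak
  ; rowPrimed = rowsPrimed
  ; colUnprimed = colsUnprimed
  }
  where open OneBoxChange T P r c e' hq F

-- The index of an entry is half its rank; hence rank is injective.
idx-fromRank : ∀ e → idx e ≡ ⌊ rank e /2⌋
idx-fromRank (pr n) = n≡⌊n+n/2⌋ n
idx-fromRank (un n) = n≡⌈n+n/2⌉ n

rank-injective : ∀ x y → rank x ≡ rank y → x ≡ y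
rank-injective x y e with trans (idx-fromRank x) (trans (cong ⌊_/2⌋ e) (sym (idx-fromRank y)))
rank-injective (pr a) (pr .a) e | refl = refl
rank-injective (un a) (un .a) e | refl = refl
rank-injective (pr a) (un .a) e | refl = ⊥-elim (1+n≢n (sym e))
rank-injective (un a) (pr .a) e | refl = ⊥-elim (1+n≢n e)

rank-< : ∀ x y → rank x ≤ rank y → x ≢ y → rank x < rank y
rank-< x y le ne = ≤∧≢⇒< le (ne ∘ rank-injective x y)

rank-j' : ∀ i → rank (pr (suc i)) ≡ suc (rank (un i))
rank-j' i = +-suc (suc i) i

rank-j : ∀ i → rank (un (suc i)) ≡ suc (suc (rank (un i)))
rank-j i = cong suc (rank-j' i)

between-i-j' : ∀ i x → rank (un i) ≤ rank x → rank x ≤ suc (rank (un i)) → x ≡ un i ⊎ x ≡ pr (suc i)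
between-i-j' i x lo hi with m≤n⇒m<n∨m≡n lo
... | inj₁ lt = inj₂ (rank-injective x (pr (suc i)) (trans (≤-antisym hi lt) (sym (rank-j' i))))
... | inj₂ eq = inj₁ (rank-injective x (un i) (sym eq))

≡ᵇ-refl : ∀ n → (n ≡ᵇ n) ≡ true
≡ᵇ-refl n = Equivalence.to T-≡ (≡⇒≡ᵇ n n refl)

≡ᵇ-false : ∀ m n → m ≢ n → (m ≡ᵇ n) ≡ false
≡ᵇ-false m n ne = ¬-not (λ e → ne (≡ᵇ⇒≡ m n (Equivalence.from T-≡ e)))

eqE-sound : ∀ x e → eqE x e ≡ true → x ≡ e
eqE-sound (pr a) (pr b) h = cong pr (≡ᵇ⇒≡ a b (Equivalence.from T-≡ h))
eqE-sound (un a) (un b) h = cong un (≡ᵇ⇒≡ a b (Equivalence.from T-≡ h))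

eqE-refl : ∀ e → eqE e e ≡ true
eqE-refl (pr a) = ≡ᵇ-refl a
eqE-refl (un a) = ≡ᵇ-refl a

inIJ'-true : ∀ i m → inIJ' i m ≡ true → Σ Entry (λ x → m ≡ just x × (x ≡ un i ⊎ x ≡ pr (suc i)))
inIJ'-true i (just x) h with eqE x (un i) in eI
... | true = x , refl , inj₁ (eqE-sound x (un i) eI)
... | false = x , refl , inj₂ (eqE-sound x (pr (suc i)) h)

inIJ'-intro : ∀ i x → x ≡ un i ⊎ x ≡ pr (suc i) → inIJ' i (just x) ≡ true
inIJ'-intro i _ (inj₁ refl) rewrite eqE-refl (un i) = refl
inIJ'-intro i _ (inj₂ refl) rewrite eqE-refl (pr (suc i)) = ∨-zeroʳ (eqE (pr (suc i)) (un i))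

inIJ'-false : ∀ i x → inIJ' i (just x) ≡ false → x ≢ un i × x ≢ pr (suc i)
inIJ'-false i x h = (λ e → false≢true (inIJ'-intro i x (inj₁ e))) , (λ e → false≢true (inIJ'-intro i x (inj₂ e)))
  where
    false≢true : inIJ' i (just x) ≡ true → ⊥
    false≢true e with trans (sym h) e
    ... | ()

Box : Tableau → Pos → Set
Box T q = Σ Entry (λ e → entryAt T q ≡ just e)

rowEntry-bounds : ∀ o w b {e} → rowEntry o w b ≡ just e → o ≤ b × b < o + length w
rowEntry-bounds zero (x ∷ w) zero eq = z≤n , s≤s z≤n
rowEntry-bounds zero (x ∷ w) (suc b) eq = z≤n , s≤s (proj₂ (rowEntry-bounds zero w b eq))
rowEntry-bounds (suc o) w (suc b) eq = Data.Product.map s≤s s≤s (rowEntry-bounds o w b eq)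

rowEntry-exists : ∀ o w b → o ≤ b → b < o + length w → Σ Entry (λ e → rowEntry o w b ≡ just e)
rowEntry-exists zero (x ∷ w) zero le lt = x , refl
rowEntry-exists zero (x ∷ w) (suc b) le (s≤s lt) = rowEntry-exists zero w b z≤n lt
rowEntry-exists (suc o) w (suc b) (s≤s le) (s≤s lt) = rowEntry-exists o w b le lt

box→row : ∀ T a b {e} → entryAt T (a , b) ≡ just e →
  Σ ℕ (λ o → Σ (List Entry) (λ w → nth T a ≡ just (o , w) × o ≤ b × b < o + length w))
box→row T a b eq with entryAt-inRow T a b eq
... | o , w , hr , hc = o , w , hr , rowEntry-bounds o w b hc

row→box : ∀ T a b {o w} → nth T a ≡ just (o , w) → o ≤ b → b < o + length w → Box T (a , b)
row→box T a b {o} {w} hr le lt with rowEntry-exists o w b le lt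
... | e , hc = e , trans (entryAt-fromRow T a b hr) hc

nth-pred : {A : Set} (xs : List A) (n : ℕ) {x : A} → nth xs (suc n) ≡ just x → Σ A (λ y → nth xs n ≡ just y)
nth-pred (y ∷ xs) zero eq = y , refl
nth-pred (y ∷ xs) (suc n) eq = nth-pred xs n eq

module Geometry (T : Tableau) (P : IsPrimedTableau T) where
  open IsPrimedTableau P

  rowsAbove : ∀ d a {o' w'} → nth T (d + a) ≡ just (o' , w') →
    Σ ℕ (λ o → Σ (List Entry) (λ w → nth T a ≡ just (o , w) × o' ≤ o × o' + length w' ≤ o + length w))
  rowsAbove zero a hr = _ , _ , hr , ≤-refl , ≤-refl
  rowsAbove (suc d) a {o'} {w'} hr with nth-pred T (d + a) hr
  ... | (o₁ , w₁) , hr₁ with rowsAbove d a hr₁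
  ...   | o , w , hr₀ , le₁ , le₂ = o , w , hr₀ , ≤-trans (shapeμ (d + a) o₁ w₁ o' w' hr₁ hr) le₁ ,
                                     ≤-trans (shapeλ (d + a) o₁ w₁ o' w' hr₁ hr) le₂

  rowAbove : ∀ a a' {o' w'} → a ≤ a' → nth T a' ≡ just (o' , w') →
    Σ ℕ (λ o → Σ (List Entry) (λ w → nth T a ≡ just (o , w) × o' ≤ o × o' + length w' ≤ o + length w))
  rowAbove a a' le hr = rowsAbove (a' ∸ a) a (trans (cong (nth T) (m∸n+n≡m le)) hr)

  colBetween : ∀ a a' k b → a ≤ k → k ≤ a' → Box T (a , b) → Box T (a' , b) → Box T (k , b)
  colBetween a a' k b le₁ le₂ (e , h) (e' , h') with box→row T a b h | box→row T a' b h'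
  ... | o , w , hr , ob , _ | _ , _ , hr' , _ , bl' with rowAbove k a' le₂ hr'
  ...   | ok , _ , hrk , _ , lk with rowAbove a k le₁ hrk
  ...     | _ , _ , hr₂ , ok≤ , _ =
            row→box T k b hrk (≤-trans ok≤ (subst (_≤ b) (cong proj₁ (just-injective (trans (sym hr) hr₂))) ob))
              (<-≤-trans bl' lk)

  rowBetween : ∀ a b b' k → b ≤ k → k ≤ b' → Box T (a , b) → Box T (a , b') → Box T (a , k)
  rowBetween a b b' k le₁ le₂ (e , h) (e' , h') with box→row T a b h | box→row T a b' h'
  ... | o , w , hr , ob , _ | _ , _ , hr' , _ , bl' =
      row→box T a k hr' (subst (_≤ k) (cong proj₁ (just-injective (trans (sym hr) hr'))) (≤-trans ob le₁))
        (≤-<-trans le₂ bl')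

  boxAbove : ∀ a b b' → b ≤ b' → Box T (a , b) → Box T (suc a , b') → Box T (a , b')
  boxAbove a b b' le (e , h) (e' , h') with box→row T a b h | box→row T (suc a) b' h'
  ... | o , w , hr , ob , _ | o' , w' , hr' , _ , bl' =
      row→box T a b' hr (≤-trans ob le) (<-≤-trans bl' (shapeλ a o w o' w' hr hr'))

  colMono : ∀ a a' b {x x'} → a ≤ a' → entryAt T (a , b) ≡ just x → entryAt T (a' , b) ≡ just x' → rank x ≤ rank x'
  colMono a a' b le h h' = go (a' ∸ a) a h (subst (λ t → entryAt T (t , b) ≡ just _) (sym (m∸n+n≡m le)) h')
    where
      go : ∀ d a {x x'} → entryAt T (a , b) ≡ just x → entryAt T (d + a , b) ≡ just x' → rank x ≤ rank x'
      go zero a h h' = ≤-reflexive (cong rank (just-injective (trans (sym h) h')))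
      go (suc d) a {x} {x'} h h' with colBetween a (suc d + a) (suc a) b (n≤1+n a) (s≤s (m≤n+m a d)) (x , h) (x' , h')
      ... | z , hz = ≤-trans (colWeak a b x z h hz)
                       (go d (suc a) hz (subst (λ t → entryAt T (t , b) ≡ just x') (sym (+-suc d a)) h'))

  rowMono : ∀ a b b' {x x'} → b ≤ b' → entryAt T (a , b) ≡ just x → entryAt T (a , b') ≡ just x' → rank x ≤ rank x'
  rowMono a b b' le h h' = go (b' ∸ b) b h (subst (λ t → entryAt T (a , t) ≡ just _) (sym (m∸n+n≡m le)) h')
    where
      go : ∀ d b {x x'} → entryAt T (a , b) ≡ just x → entryAt T (a , d + b) ≡ just x' → rank x ≤ rank x'
      go zero b h h' = ≤-reflexive (cong rank (just-injective (trans (sym h) h')))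
      go (suc d) b {x} {x'} h h' with rowBetween a b (suc d + b) (suc b) (n≤1+n b) (s≤s (m≤n+m b d)) (x , h) (x' , h')
      ... | z , hz = ≤-trans (rowWeak a b x z h hz)
                       (go d (suc b) hz (subst (λ t → entryAt T (a , t) ≡ just x') (sym (+-suc d b)) h'))

Word : Set
Word = List (Pos × ℕ)

letterAt : Pos → Maybe Entry → Word
letterAt q (just (un a)) = (q , a) ∷ []
letterAt q _ = []

segment : (ℕ → Maybe Entry) → ℕ → ℕ → ℕ → Word
segment f r lo zero = []
segment f r lo (suc n) = letterAt (r , lo) (f lo) ++ segment f r (suc lo) n

segment-ext : ∀ f g r lo n → (∀ k → lo ≤ k → f k ≡ g k) → segment f r lo n ≡ segment g r lo n
segment-ext f g r lo zero e = refl
segment-ext f g r lo (suc n) e = cong₂ _++_ (cong (letterAt (r , lo)) (e lo ≤-refl))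
  (segment-ext f g r (suc lo) n (λ k le → e k (≤-trans (n≤1+n lo) le)))

segment-empty : ∀ f r lo n → (∀ k → k < lo + n → f k ≡ nothing) → segment f r lo n ≡ []
segment-empty f r lo zero e = refl
segment-empty f r lo (suc n) e rewrite e lo (subst (lo <_) (sym (+-suc lo n)) (s≤s (m≤m+n lo n))) =
  segment-empty f r (suc lo) n (λ k lt → e k (subst (k <_) (sym (+-suc lo n)) lt))

segment-++ : ∀ f r lo m n → segment f r lo (m + n) ≡ segment f r lo m ++ segment f r (m + lo) n
segment-++ f r lo zero n = refl
segment-++ f r lo (suc m) n = trans (cong (letterAt (r , lo) (f lo) ++_)
    (trans (segment-++ f r (suc lo) m n) (cong (λ t → segment f r (suc lo) m ++ segment f r t n) (+-suc m lo))))
  (sym (++-assoc (letterAt (r , lo) (f lo)) _ _))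

∸-suc : ∀ a b → a < b → b ∸ a ≡ suc (b ∸ suc a)
∸-suc zero (suc b) lt = refl
∸-suc (suc a) (suc b) (s≤s lt) = ∸-suc a b lt

segment-uncons : ∀ f r lo B → lo < B → segment f r lo (B ∸ lo) ≡ letterAt (r , lo) (f lo) ++ segment f r (suc lo) (B ∸ suc lo)
segment-uncons f r lo B lt rewrite ∸-suc lo B lt = refl

segment-snoc : ∀ f r b → segment f r 0 (suc b) ≡ segment f r 0 b ++ letterAt (r , b) (f b)
segment-snoc f r b = trans (cong (segment f r 0) (+-comm 1 b))
  (trans (segment-++ f r 0 b 1)
    (cong (segment f r 0 b ++_) (trans (cong (λ t → letterAt (r , t) (f t) ++ []) (+-identityʳ b)) (++-identityʳ _))))

rowEntry-self : ∀ c x w → rowEntry c (x ∷ w) c ≡ just x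
rowEntry-self zero x w = refl
rowEntry-self (suc c) x w = rowEntry-self c x w

rowEntry-shift : ∀ c x w k → c < k → rowEntry c (x ∷ w) k ≡ rowEntry (suc c) w k
rowEntry-shift zero x w (suc k) lt = refl
rowEntry-shift (suc c) x w (suc k) (s≤s lt) = rowEntry-shift c x w k lt

rowEntry-left : ∀ o w k → k < o → rowEntry o w k ≡ nothing
rowEntry-left (suc o) w zero lt = refl
rowEntry-left (suc o) w (suc k) (s≤s lt) = rowEntry-left o w k lt

rowWord-segment : ∀ r c w → rowWord r c w ≡ segment (rowEntry c w) r c (length w)
rowWord-segment r c [] = refl
rowWord-segment r c (pr a ∷ w) rewrite rowEntry-self c (pr a) w =
  trans (rowWord-segment r (suc c) w)
    (segment-ext _ _ r (suc c) (length w) (λ k le → sym (rowEntry-shift c (pr a) w k le)))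
rowWord-segment r c (un a ∷ w) rewrite rowEntry-self c (un a) w =
  cong (((r , c) , a) ∷_) (trans (rowWord-segment r (suc c) w)
    (segment-ext _ _ r (suc c) (length w) (λ k le → sym (rowEntry-shift c (un a) w k le))))

rowWord-segment₀ : ∀ r o w → rowWord r o w ≡ segment (rowEntry o w) r 0 (o + length w)
rowWord-segment₀ r o w = trans (rowWord-segment r o w)
  (trans (cong (λ t → segment (rowEntry o w) r t (length w)) (sym (+-identityʳ o)))
  (sym (trans (segment-++ (rowEntry o w) r 0 o (length w))
    (cong (_++ segment (rowEntry o w) r (o + 0) (length w)) (segment-empty _ r 0 o (λ k lt → rowEntry-left o w k lt))))))

module ReadingWord (T : Tableau) where
  rowFn : ℕ → ℕ → Maybe Entry
  rowFn r k = entryAt T (r , k)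

  rowEnd : ℕ → ℕ
  rowEnd r with nth T r
  ... | nothing = 0
  ... | just (o , w) = o + length w

  rowEnd-row : ∀ r {o w} → nth T r ≡ just (o , w) → rowEnd r ≡ o + length w
  rowEnd-row r eq with nth T r
  ... | just _ = cong (λ { (just (o , w)) → o + length w ; nothing → 0 }) eq

  rowLetters : ℕ → Word
  rowLetters r = segment (rowFn r) r 0 (rowEnd r)

  rows : ℕ → ℕ → Word
  rows a zero = []
  rows a (suc m) = rows (suc a) m ++ rowLetters a

  rowWord-letters : ∀ r {o w} → nth T r ≡ just (o , w) → rowWord r o w ≡ rowLetters r
  rowWord-letters r {o} {w} eq = trans (rowWord-segment₀ r o w)
    (trans (segment-ext _ _ r 0 (o + length w) (λ k _ → sym (entryAt-fromRow T r k eq)))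
      (cong (segment (rowFn r) r 0) (sym (rowEnd-row r eq))))

  readingWord-rows : readingWord T ≡ rows 0 (length T)
  readingWord-rows = go T 0 (λ k → cong (nth T) (+-identityʳ k))
    where
      go : ∀ T' a → (∀ k → nth T (k + a) ≡ nth T' k) → readingWordFrom a T' ≡ rows a (length T')
      go [] a h = refl
      go ((o , w) ∷ T') a h = cong₂ _++_ (go T' (suc a) (λ k → trans (cong (nth T) (+-suc k a)) (h (suc k))))
                                        (rowWord-letters a (h 0))

  rows-++ : ∀ a m n → rows a (m + n) ≡ rows (m + a) n ++ rows a m
  rows-++ a zero n = sym (++-identityʳ (rows a n))
  rows-++ a (suc m) n = trans (cong (_++ rowLetters a) (rows-++ (suc a) m n))
    (trans (++-assoc (rows (m + suc a) n) _ _) (cong (_++ (rows (suc a) m ++ rowLetters a)) (cong (λ t → rows t n) (+-suc m a))))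

  rowLetters-split : ∀ a b → b ≤ rowEnd a → rowLetters a ≡ segment (rowFn a) a 0 b ++ segment (rowFn a) a b (rowEnd a ∸ b)
  rowLetters-split a b le = trans (cong (segment (rowFn a) a 0) (sym (m+[n∸m]≡n le)))
    (trans (segment-++ (rowFn a) a 0 b (rowEnd a ∸ b)) (cong (λ t → segment (rowFn a) a 0 b ++ segment (rowFn a) a t (rowEnd a ∸ b)) (+-identityʳ b)))

  letterAt-mem : ∀ q q' x m → (q' , x) ∈ letterAt q m → q' ≡ q × m ≡ just (un x)
  letterAt-mem q q' x (just (un a)) (here refl) = refl , refl

  segment-mem : ∀ f r lo n q x → (q , x) ∈ segment f r lo n →
    proj₁ q ≡ r × lo ≤ proj₂ q × proj₂ q < lo + n × f (proj₂ q) ≡ just (un x)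
  segment-mem f r lo (suc n) q x m with ∈-++⁻ (letterAt (r , lo) (f lo)) m
  ... | inj₁ m₁ with letterAt-mem (r , lo) q x (f lo) m₁
  ...   | refl , e = refl , ≤-refl , subst (lo <_) (sym (+-suc lo n)) (s≤s (m≤m+n lo n)) , e
  segment-mem f r lo (suc n) q x m | inj₂ m₂ with segment-mem f r (suc lo) n q x m₂
  ... | e₁ , e₂ , e₃ , e₄ = e₁ , ≤-trans (n≤1+n lo) e₂ , subst (proj₂ q <_) (sym (+-suc lo n)) e₃ , e₄

  rows-mem : ∀ a m q x → (q , x) ∈ rows a m → a ≤ proj₁ q × proj₁ q < a + m × entryAt T q ≡ just (un x)
  rows-mem a (suc m) q x mm with ∈-++⁻ (rows (suc a) m) mm
  ... | inj₁ m₁ with rows-mem (suc a) m q x m₁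
  ...   | e₁ , e₂ , e₃ = ≤-trans (n≤1+n a) e₁ , subst (proj₁ q <_) (sym (+-suc a m)) e₂ , e₃
  rows-mem a (suc m) (r , c) x mm | inj₂ m₂ with segment-mem (rowFn a) a 0 (rowEnd a) (r , c) x m₂
  ... | refl , _ , _ , e₄ = ≤-refl , subst (r <_) (sym (+-suc r m)) (s≤s (m≤m+n r m)) , e₄

  readingWord-mem : ∀ q x → (q , x) ∈ readingWord T → entryAt T q ≡ just (un x)
  readingWord-mem q x m = proj₂ (proj₂ (rows-mem 0 (length T) q x (subst ((q , x) ∈_) readingWord-rows m)))

count : ℕ → Word → ℕ
count n [] = 0
count n ((p , a) ∷ ws) = if a ≡ᵇ n then suc (count n ws) else count n ws

count-++ : ∀ n xs ys → count n (xs ++ ys) ≡ count n xs + count n ys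
count-++ n [] ys = refl
count-++ n ((p , a) ∷ xs) ys with a ≡ᵇ n
... | true = cong suc (count-++ n xs ys)
... | false = count-++ n xs ys

count-same : ∀ n q ws → count n ((q , n) ∷ ws) ≡ suc (count n ws)
count-same n q ws rewrite ≡ᵇ-refl n = refl

count-other : ∀ n q a ws → a ≢ n → count n ((q , a) ∷ ws) ≡ count n ws
count-other n q a ws ne rewrite ≡ᵇ-false a n ne = refl

count-letterAt-other : ∀ n q m → m ≢ just (un n) → count n (letterAt q m) ≡ 0
count-letterAt-other n q nothing ne = refl
count-letterAt-other n q (just (pr a)) ne = refl
count-letterAt-other n q (just (un a)) ne rewrite ≡ᵇ-false a n (ne ∘ cong (just ∘ un)) = refl

count-letterAt-same : ∀ n q → count n (letterAt q (just (un n))) ≡ 1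
count-letterAt-same n q rewrite ≡ᵇ-refl n = refl

count-letterAt-≤1 : ∀ n q m → count n (letterAt q m) ≤ 1
count-letterAt-≤1 n q nothing = z≤n
count-letterAt-≤1 n q (just (pr a)) = z≤n
count-letterAt-≤1 n q (just (un a)) with a ≡ᵇ n
... | true = ≤-refl
... | false = z≤n

count-segment-none : ∀ n f r lo len → (∀ k → lo ≤ k → k < lo + len → f k ≢ just (un n)) → count n (segment f r lo len) ≡ 0
count-segment-none n f r lo zero h = refl
count-segment-none n f r lo (suc len) h = trans (count-++ n (letterAt (r , lo) (f lo)) _)
  (cong₂ _+_ (count-letterAt-other n (r , lo) (f lo) (h lo ≤-refl (subst (lo <_) (sym (+-suc lo len)) (s≤s (m≤m+n lo len)))))
     (count-segment-none n f r (suc lo) len (λ k le lt → h k (≤-trans (n≤1+n lo) le) (subst (k <_) (sym (+-suc lo len)) lt))))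

count-segment-tail : ∀ n f r lo B → count n (segment f r lo (B ∸ lo)) ≤ suc (count n (segment f r (suc lo) (B ∸ suc lo)))
count-segment-tail n f r lo B with lo <? B
... | yes lt rewrite segment-uncons f r lo B lt | count-++ n (letterAt (r , lo) (f lo)) (segment f r (suc lo) (B ∸ suc lo)) =
      +-monoˡ-≤ _ (count-letterAt-≤1 n (r , lo) (f lo))
... | no nlt rewrite m≤n⇒m∸n≡0 (≮⇒≥ nlt) = z≤n

scanStep : ℕ → List Pos → Pos × ℕ → List Pos
scanStep i st (p , a) = if a ≡ᵇ suc i then p ∷ st else if a ≡ᵇ i then drop 1 st else st

bracketScan-step : ∀ i st p a ws → bracketScan i st ((p , a) ∷ ws) ≡ bracketScan i (scanStep i st (p , a)) ws
bracketScan-step i [] p a ws with a ≡ᵇ suc i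
... | true = refl
... | false with a ≡ᵇ i
...   | true = refl
...   | false = refl
bracketScan-step i (x ∷ st) p a ws with a ≡ᵇ suc i
... | true = refl
... | false with a ≡ᵇ i
...   | true = refl
...   | false = refl

bracketScan-++ : ∀ i st xs ys → bracketScan i st (xs ++ ys) ≡ bracketScan i (bracketScan i st xs) ys
bracketScan-++ i st [] ys = refl
bracketScan-++ i st ((p , a) ∷ xs) ys = trans (bracketScan-step i st p a (xs ++ ys))
  (trans (bracketScan-++ i (scanStep i st (p , a)) xs ys) (cong (λ s → bracketScan i s ys) (sym (bracketScan-step i st p a xs))))

bracketScan-pushJ : ∀ i st q ws → bracketScan i st ((q , suc i) ∷ ws) ≡ bracketScan i (q ∷ st) ws
bracketScan-pushJ i st q ws rewrite bracketScan-step i st q (suc i) ws | ≡ᵇ-refl i = refl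

bracketScan-popI : ∀ i st q ws → bracketScan i st ((q , i) ∷ ws) ≡ bracketScan i (drop 1 st) ws
bracketScan-popI i st q ws rewrite bracketScan-step i st q i ws | ≡ᵇ-false i (suc i) (1+n≢n ∘ sym) | ≡ᵇ-refl i = refl

bracketScan-skip : ∀ i st q a ws → a ≢ suc i → a ≢ i → bracketScan i st ((q , a) ∷ ws) ≡ bracketScan i st ws
bracketScan-skip i st q a ws ne₁ ne₂ rewrite bracketScan-step i st q a ws | ≡ᵇ-false a (suc i) ne₁ | ≡ᵇ-false a i ne₂ = refl

∈-drop : {A : Set} {x : A} (k : ℕ) (xs : List A) → x ∈ drop k xs → x ∈ xs
∈-drop zero xs m = m
∈-drop (suc k) (y ∷ xs) m = there (∈-drop k xs m)

drop-suc : {A : Set} (k : ℕ) (st : List A) → drop k (drop 1 st) ≡ drop (suc k) st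
drop-suc k [] = drop-[] k
drop-suc k (x ∷ st) = refl

record ScanShape (i : ℕ) (st : List Pos) (ws : Word) : Set where
  field
    pushed : List Pos
    popped : ℕ
    result : bracketScan i st ws ≡ pushed ++ drop popped st
    pushedJ : ∀ q → q ∈ pushed → (q , suc i) ∈ ws
    balance : length pushed + count i ws ≡ popped + count (suc i) ws

scanShape : ∀ i st ws → ScanShape i st ws
scanShape i st [] = record { pushed = [] ; popped = 0 ; result = refl ; pushedJ = λ q () ; balance = refl }
scanShape i st ((p , a) ∷ ws) with a ≟ suc i
... | yes refl = pushP (ScanShape.popped S) refl
  where
    S = scanShape i (p ∷ st) ws
    open ScanShape S using (pushed; result; pushedJ; balance)
    pushP : ∀ k → ScanShape.popped S ≡ k → ScanShape i st ((p , suc i) ∷ ws)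
    pushP zero e = record
      { pushed = pushed ++ p ∷ [] ; popped = 0
      ; result = trans (bracketScan-pushJ i st p ws) (trans result (trans (cong (λ k → pushed ++ drop k (p ∷ st)) e) (sym (++-assoc pushed (p ∷ []) st))))
      ; pushedJ = λ q m → Data.Sum.[ (λ m₁ → there (pushedJ q m₁)) , (λ { (here refl) → here refl }) ] (∈-++⁻ pushed m)
      ; balance = trans (cong₂ _+_ (trans (length-++ pushed) (+-comm (length pushed) 1)) (count-other i p (suc i) ws 1+n≢n))
                        (trans (cong suc (trans balance (cong (_+ count (suc i) ws) e))) (sym (count-same (suc i) p ws))) }
    pushP (suc k) e = record
      { pushed = pushed ; popped = k
      ; result = trans (bracketScan-pushJ i st p ws) (trans result (cong (λ k → pushed ++ drop k (p ∷ st)) e))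
      ; pushedJ = λ q m → there (pushedJ q m)
      ; balance = trans (cong (length pushed +_) (count-other i p (suc i) ws 1+n≢n))
                  (trans balance (trans (cong (_+ count (suc i) ws) e)
                  (trans (sym (+-suc k _)) (cong (k +_) (sym (count-same (suc i) p ws)))))) }
scanShape i st ((p , a) ∷ ws) | no a≢j with a ≟ i
... | yes refl = record
      { pushed = pushed ; popped = suc popped
      ; result = trans (bracketScan-popI i st p ws) (trans result (cong (pushed ++_) (drop-suc popped st)))
      ; pushedJ = λ q m → there (pushedJ q m)
      ; balance = trans (cong (length pushed +_) (count-same i p ws)) (trans (+-suc (length pushed) _)
                  (trans (cong suc balance) (cong (suc popped +_) (sym (count-other (suc i) p i ws (1+n≢n ∘ sym)))))) }
  where open ScanShape (scanShape i (drop 1 st) ws)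
... | no a≢i = record
      { pushed = pushed ; popped = popped ; result = trans (bracketScan-skip i st p a ws a≢j a≢i) result
      ; pushedJ = λ q m → there (pushedJ q m)
      ; balance = trans (cong (length pushed +_) (count-other i p a ws a≢i))
                  (trans balance (cong (popped +_) (sym (count-other (suc i) p a ws a≢j)))) }
  where open ScanShape (scanShape i st ws)

bracketScan-j : ∀ i ws q → q ∈ bracketScan i [] ws → (q , suc i) ∈ ws
bracketScan-j i ws q m with ∈-++⁻ pushed (subst (q ∈_) result m)
  where open ScanShape (scanShape i [] ws)
... | inj₁ m₁ = ScanShape.pushedJ (scanShape i [] ws) q m₁
... | inj₂ m₂ with ∈-drop (ScanShape.popped (scanShape i [] ws)) [] m₂
...   | ()

nth-<length : {A : Set} (xs : List A) (n : ℕ) {x : A} → nth xs n ≡ just x → n < length xs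
nth-<length (y ∷ xs) zero eq = s≤s z≤n
nth-<length (y ∷ xs) (suc n) eq = s≤s (nth-<length xs n eq)

head-reverse : {A : Set} (xs : List A) {y : A} {rest : List A} → reverse xs ≡ y ∷ rest → y ∈ xs
head-reverse xs {y} eq = reverse⁻ (subst (y ∈_) (sym eq) (here refl))

-- If y is the bottom
-- element of a stack obtained from y ∷ W ∷ s by popping k elements and
-- pushing Z, then y lies in Z or in W ∷ s (if nothing was popped, W and s
-- lie below y).
headOfStack : ∀ (Z : List Pos) k y W s {rest} → reverse (Z ++ drop k (y ∷ W ∷ s)) ≡ y ∷ rest → y ∈ Z ⊎ y ∈ (W ∷ s)
headOfStack Z (suc k) y W s eq with ∈-++⁻ Z (head-reverse (Z ++ drop k (W ∷ s)) eq)
... | inj₁ m = inj₁ m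
... | inj₂ m = inj₂ (∈-drop k (W ∷ s) m)
headOfStack Z zero y W s {rest} eq = inj₂ (yFromBelow (lastTwo (reverse s) reversed))
  where
    reversed : ((reverse s ∷ʳ W) ∷ʳ y) ++ reverse Z ≡ y ∷ rest
    reversed = trans (cong (λ t → (t ∷ʳ y) ++ reverse Z) (sym (unfold-reverse W s)))
      (trans (cong (_++ reverse Z) (sym (unfold-reverse y (W ∷ s)))) (trans (sym (reverse-++ Z (y ∷ W ∷ s))) eq))
    lastTwo : ∀ (l : List Pos) {R : List Pos} → ((l ∷ʳ W) ∷ʳ y) ++ R ≡ y ∷ rest → y ≡ W ⊎ y ∈ l
    lastTwo [] refl = inj₁ refl
    lastTwo (u ∷ us) refl = inj₂ (here refl)
    yFromBelow : y ≡ W ⊎ y ∈ reverse s → y ∈ (W ∷ s)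
    yFromBelow (inj₁ e) = here e
    yFromBelow (inj₂ m) = there (reverse⁻ m)

leftmost-unbracketed : ∀ i T {y} → leftmostUnbracketedJ i T ≡ just y → Σ (List Pos) (λ rest → unbracketedJ i T ≡ y ∷ rest)
leftmost-unbracketed i T eq with unbracketedJ i T
... | y' ∷ rest with refl ← eq = rest , refl

module LeftmostJ (T : Tableau) (i r c : ℕ) (rest : List Pos) (hU : unbracketedJ i T ≡ (r , c) ∷ rest) where
  open ReadingWord T

  y : Pos
  y = (r , c)

  final : List Pos
  final = bracketScan i [] (readingWord T)

  y∈final : y ∈ final
  y∈final = head-reverse final hU

  y-holds-j : entryAt T y ≡ just (un (suc i))
  y-holds-j = readingWord-mem y (suc i) (bracketScan-j i (readingWord T) y y∈final)

  private
    yRow = box→row T r c y-holds-j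

  c<rowEnd : c < rowEnd r
  c<rowEnd = subst (c <_) (sym (rowEnd-row r (proj₁ (proj₂ (proj₂ yRow))))) (proj₂ (proj₂ (proj₂ (proj₂ yRow))))

  r<length : r < length T
  r<length = nth-<length T r (proj₁ (proj₂ (proj₂ yRow)))

  below : ℕ
  below = length T ∸ suc r
  right : ℕ
  right = rowEnd r ∸ suc c

  before : Word
  before = rows (suc r) below ++ segment (rowFn r) r 0 c
  after : Word
  after = segment (rowFn r) r (suc c) right ++ rows 0 r

  readingWord-rowR : readingWord T ≡ rows (suc r) below ++ rowLetters r ++ rows 0 r
  readingWord-rowR = trans readingWord-rows (trans (cong (rows 0) lengthEq)
    (trans (rows-++ 0 r (suc below)) (trans (cong (λ t → rows t (suc below) ++ rows 0 r) (+-identityʳ r))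
      (++-assoc (rows (suc r) below) (rowLetters r) (rows 0 r)))))
    where
      lengthEq : length T ≡ r + suc below
      lengthEq = trans (sym (m+[n∸m]≡n r<length)) (sym (+-suc r below))

  rowLetters-around : ∀ c₀ n₀ → rowEnd r ≡ c₀ + suc n₀ →
    rowLetters r ≡ segment (rowFn r) r 0 c₀ ++ (letterAt (r , c₀) (rowFn r c₀) ++ segment (rowFn r) r (suc c₀) n₀)
  rowLetters-around c₀ n₀ e = trans (cong (segment (rowFn r) r 0) e)
    (trans (segment-++ (rowFn r) r 0 c₀ (suc n₀)) (cong (λ t → segment (rowFn r) r 0 c₀ ++ segment (rowFn r) r t (suc n₀)) (+-identityʳ c₀)))

  rowEnd-eq : rowEnd r ≡ c + suc right
  rowEnd-eq = trans (sym (m+[n∸m]≡n c<rowEnd)) (sym (+-suc c right))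

  readingWord-around-y : readingWord T ≡ before ++ (y , suc i) ∷ after
  readingWord-around-y = trans readingWord-rowR (trans (cong (λ t → rows (suc r) below ++ t ++ rows 0 r)
     (trans (rowLetters-around c right rowEnd-eq)
       (cong (λ t → segment (rowFn r) r 0 c ++ (letterAt (r , c) t ++ segment (rowFn r) r (suc c) right)) y-holds-j)))
     (trans (cong (rows (suc r) below ++_) (++-assoc (segment (rowFn r) r 0 c) _ (rows 0 r)))
       (sym (++-assoc (rows (suc r) below) (segment (rowFn r) r 0 c) _))))

  y∉before : ∀ n x → n ≤ c → (y , x) ∈ rows (suc r) below ++ segment (rowFn r) r 0 n → ⊥
  y∉before n x le m with ∈-++⁻ (rows (suc r) below) m
  ... | inj₁ m₁ = 1+n≰n (proj₁ (rows-mem (suc r) below y x m₁))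
  ... | inj₂ m₂ = 1+n≰n (≤-trans (proj₁ (proj₂ (proj₂ (segment-mem (rowFn r) r 0 n y x m₂)))) le)

  y∉after : ∀ x → (y , x) ∈ after → ⊥
  y∉after x m with ∈-++⁻ (segment (rowFn r) r (suc c) right) m
  ... | inj₁ m₁ = 1+n≰n (proj₁ (proj₂ (segment-mem (rowFn r) r (suc c) right y x m₁)))
  ... | inj₂ m₂ = 1+n≰n (proj₁ (proj₂ (rows-mem 0 r y x m₂)))

  -- y is unbracketed: every prefix S of the word after y has at least as
  -- many j's as i's (otherwise some i in S would close y).
  after-balanced : ∀ S rest' → after ≡ S ++ rest' → count (suc i) S < count i S → ⊥
  after-balanced S rest' split lt with scanShape i (y ∷ bracketScan i [] before) S
  ... | record { pushed = Z₁ ; popped = zero ; balance = bal } =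
        <-irrefl refl (<-≤-trans lt (subst (count i S ≤_) bal (m≤n+m (count i S) (length Z₁))))
  ... | record { pushed = Z₁ ; popped = suc k₁ ; result = res₁ ; pushedJ = J₁ } =
        yNowhere (∈-++⁻ Z₂ (subst (y ∈_) finalEq y∈final))
    where
      s₀ = bracketScan i [] before
      open ScanShape (scanShape i (Z₁ ++ drop k₁ s₀) rest') renaming (pushed to Z₂; popped to k₂; result to res₂; pushedJ to J₂)
      finalEq : final ≡ Z₂ ++ drop k₂ (Z₁ ++ drop k₁ s₀)
      finalEq = trans (cong (bracketScan i []) (trans readingWord-around-y (cong (λ t → before ++ (y , suc i) ∷ t) split)))
        (trans (bracketScan-++ i [] before ((y , suc i) ∷ S ++ rest'))
        (trans (bracketScan-++ i s₀ ((y , suc i) ∷ S) rest')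
        (trans (cong (λ t → bracketScan i t rest') (trans (bracketScan-pushJ i s₀ y S) res₁)) res₂)))
      yNowhere : y ∈ Z₂ ⊎ y ∈ drop k₂ (Z₁ ++ drop k₁ s₀) → ⊥
      yNowhere (inj₁ m₁) = y∉after (suc i) (subst ((y , suc i) ∈_) (sym split) (∈-++⁺ʳ S (J₂ y m₁)))
      yNowhere (inj₂ m₂) with ∈-++⁻ Z₁ (∈-drop k₂ _ m₂)
      ... | inj₁ m₃ = y∉after (suc i) (subst ((y , suc i) ∈_) (sym split) (∈-++⁺ˡ (J₁ y m₃)))
      ... | inj₂ m₃ = y∉before c (suc i) ≤-refl (bracketScan-j i before y (∈-drop k₁ s₀ m₃))

  -- The box West of y does not hold j: that j would be unbracketed too and
  -- to the left of y.
  west-not-j : ∀ c' → c ≡ suc c' → entryAt T (r , c') ≡ just (un (suc i)) → ⊥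
  west-not-j c' refl hW = yNowhere (headOfStack Z k y (r , c') s₀ (trans (cong reverse (sym finalEq)) hU))
    where
      before' = rows (suc r) below ++ segment (rowFn r) r 0 c'
      s₀ = bracketScan i [] before'
      open ScanShape (scanShape i ((r , c) ∷ (r , c') ∷ s₀) after) renaming (pushed to Z; popped to k)
      wordEq : readingWord T ≡ before' ++ ((r , c') , suc i) ∷ (y , suc i) ∷ after
      wordEq = trans readingWord-rowR (trans (cong (λ t → rows (suc r) below ++ t ++ rows 0 r)
        (trans (rowLetters-around c' (suc right) (trans rowEnd-eq (sym (+-suc c' (suc right)))))
          (cong₂ (λ t u → segment (rowFn r) r 0 c' ++ (letterAt (r , c') t ++ (letterAt (r , c) u ++ segment (rowFn r) r (suc c) right)))
            hW y-holds-j)))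
        (trans (cong (rows (suc r) below ++_) (++-assoc (segment (rowFn r) r 0 c') _ (rows 0 r)))
          (sym (++-assoc (rows (suc r) below) (segment (rowFn r) r 0 c') _))))
      finalEq : final ≡ Z ++ drop k (y ∷ (r , c') ∷ s₀)
      finalEq = trans (cong (bracketScan i []) wordEq)
        (trans (bracketScan-++ i [] before' _)
        (trans (bracketScan-pushJ i s₀ (r , c') ((y , suc i) ∷ after))
        (trans (bracketScan-pushJ i ((r , c') ∷ s₀) y after) result)))
      yNowhere : y ∈ Z ⊎ y ∈ ((r , c') ∷ s₀) → ⊥
      yNowhere (inj₁ m₁) = y∉after (suc i) (pushedJ y m₁)
      yNowhere (inj₂ (here e)) = 1+n≢n (cong proj₂ e)
      yNowhere (inj₂ (there m₁)) = y∉before c' (suc i) (n≤1+n c') (bracketScan-j i before' y m₁)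

rowLength : Tableau → ℕ → ℕ
rowLength [] a = 0
rowLength ((o , w) ∷ T) zero = length w
rowLength (_ ∷ T) (suc a) = rowLength T a

sizeAbove : Tableau → ℕ → ℕ
sizeAbove T zero = 0
sizeAbove [] (suc a) = 0
sizeAbove ((o , w) ∷ T) (suc a) = length w + sizeAbove T a

sizeAbove-suc : ∀ T a → sizeAbove T (suc a) ≡ sizeAbove T a + rowLength T a
sizeAbove-suc [] zero = refl
sizeAbove-suc [] (suc a) = refl
sizeAbove-suc ((o , w) ∷ T) zero = +-comm (length w) 0
sizeAbove-suc ((o , w) ∷ T) (suc a) = trans (cong (length w +_) (sizeAbove-suc T a)) (sym (+-assoc (length w) _ _))

sizeAbove-≤ : ∀ T a → sizeAbove T a ≤ size T
sizeAbove-≤ T zero = z≤n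
sizeAbove-≤ [] (suc a) = z≤n
sizeAbove-≤ ((o , w) ∷ T) (suc a) = +-monoʳ-≤ (length w) (sizeAbove-≤ T a)

rowLength-row : ∀ T a {o w} → nth T a ≡ just (o , w) → rowLength T a ≡ length w
rowLength-row ((o , w) ∷ T) zero refl = refl
rowLength-row (x ∷ T) (suc a) e = rowLength-row T a e

module Potential (T : Tableau) where
  open ReadingWord T

  -- The boxes in rows above a plus the boxes of row a from column b on; it
  -- strictly decreases along every North or East step.
  potential : ℕ → ℕ → ℕ
  potential a b = sizeAbove T a + (rowEnd a ∸ b)

  box-rowEnd : ∀ a b {x} → entryAt T (a , b) ≡ just x → b < rowEnd a × rowEnd a ∸ b ≤ rowLength T a
  box-rowEnd a b h with box→row T a b h
  ... | o , w , hr , ob , bl = subst (b <_) (sym (rowEnd-row a hr)) bl ,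
        subst₂ _≤_ (cong (_∸ b) (sym (rowEnd-row a hr))) (sym (rowLength-row T a hr))
          (≤-trans (∸-monoʳ-≤ (o + length w) ob) (≤-reflexive (m+n∸m≡n o (length w))))

  potential-east : ∀ a b {x} → entryAt T (a , b) ≡ just x → potential a b ≡ suc (potential a (suc b))
  potential-east a b h = trans (cong (sizeAbove T a +_) (∸-suc b (rowEnd a) (proj₁ (box-rowEnd a b h)))) (+-suc _ _)

  potential-north : ∀ a b {x x'} → entryAt T (suc a , b) ≡ just x → entryAt T (a , b) ≡ just x' →
    potential a b < potential (suc a) b
  potential-north a b h h' = begin-strict
    sizeAbove T a + (rowEnd a ∸ b)                     ≤⟨ +-monoʳ-≤ (sizeAbove T a) (proj₂ (box-rowEnd a b h')) ⟩
    sizeAbove T a + rowLength T a                      ≡⟨ sym (sizeAbove-suc T a) ⟩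
    sizeAbove T (suc a)                                <⟨ m<m+n (sizeAbove T (suc a)) (s≤s z≤n) ⟩
    sizeAbove T (suc a) + suc (rowEnd (suc a) ∸ suc b) ≡⟨ cong (sizeAbove T (suc a) +_) (sym (∸-suc b (rowEnd (suc a)) (proj₁ (box-rowEnd (suc a) b h)))) ⟩
    potential (suc a) b                                ∎
    where open ≤-Reasoning

  potential-≤-size : ∀ a b {x} → entryAt T (a , b) ≡ just x → potential a b ≤ size T
  potential-≤-size a b h = ≤-trans (+-monoʳ-≤ (sizeAbove T a) (proj₂ (box-rowEnd a b h)))
    (subst (_≤ size T) (sizeAbove-suc T a) (sizeAbove-≤ T (suc a)))

++-regroup : {A : Set} (a b c d e : List A) → a ++ ((b ++ (c ++ d)) ++ e) ≡ (a ++ (b ++ c)) ++ (d ++ e)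
++-regroup a b c d e = trans (cong (a ++_) (trans (++-assoc b (c ++ d) e) (cong (b ++_) (++-assoc c d e))))
  (sym (trans (++-assoc a (b ++ c) (d ++ e)) (cong (a ++_) (++-assoc b c (d ++ e)))))

-- Invariant at a ribbon box (a , b), a < r: the letters read after y and
-- before (a , b) contain, up to the offset c, at least b + δ i's and at
-- most b j's beyond the j's of row a + 1 to the right of column b.  When
-- the ribbon stops at an i, or at a j' with δ > 0, the i's outnumber the
-- j's in a prefix of the word after y, contradicting that y is unbracketed.
module Ribbon (T : Tableau) (P : IsPrimedTableau T) (i r c : ℕ) (rest : List Pos) (hU : unbracketedJ i T ≡ (r , c) ∷ rest) where
  open IsPrimedTableau P
  open Geometry T P
  open ReadingWord T
  open LeftmostJ T i r c rest hU
  open Potential T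

  j : ℕ
  j = suc i

  Ri : ℕ
  Ri = rank (un i)

  rightOfY : Word
  rightOfY = segment (rowFn r) r (suc c) right

  readBefore : ℕ → ℕ → Word
  readBefore a b = rightOfY ++ (rows (suc a) (r ∸ suc a) ++ segment (rowFn a) a 0 b)

  jsBelowRight : ℕ → ℕ → ℕ
  jsBelowRight a b = count j (segment (rowFn (suc a)) (suc a) (suc b) (rowEnd (suc a) ∸ suc b))

  record Invariant (δ a b : ℕ) : Set where
    field
      manyIs : b + δ ≤ count i (readBefore a b) + c
      fewJs : count j (readBefore a b) + c ≤ b + jsBelowRight a b

  GoodEnd : Pos → Set
  GoodEnd p = entryAt T p ≡ just (pr j) × proj₁ p < r × AtNorth T p (λ x → rank x < Ri)

  after-split : ∀ a b → a < r → b ≤ rowEnd a → after ≡ readBefore a b ++ (segment (rowFn a) a b (rowEnd a ∸ b) ++ rows 0 a)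
  after-split a b lt le = trans (cong (rightOfY ++_) rowsEq) (++-regroup rightOfY (rows (suc a) (r ∸ suc a)) (segment (rowFn a) a 0 b) _ (rows 0 a))
    where
      rEq : r ≡ a + suc (r ∸ suc a)
      rEq = trans (sym (m+[n∸m]≡n lt)) (sym (+-suc a (r ∸ suc a)))
      rowsEq : rows 0 r ≡ (rows (suc a) (r ∸ suc a) ++ (segment (rowFn a) a 0 b ++ segment (rowFn a) a b (rowEnd a ∸ b))) ++ rows 0 a
      rowsEq = trans (cong (rows 0) rEq) (trans (rows-++ 0 a (suc (r ∸ suc a)))
        (cong (_++ rows 0 a) (trans (cong (λ t → rows t (suc (r ∸ suc a))) (+-identityʳ a))
          (cong (rows (suc a) (r ∸ suc a) ++_) (rowLetters-split a b le)))))

  readBefore-north : ∀ a b → suc a < r → b ≤ rowEnd (suc a) →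
    readBefore a b ≡ readBefore (suc a) b ++ (segment (rowFn (suc a)) (suc a) b (rowEnd (suc a) ∸ b) ++ segment (rowFn a) a 0 b)
  readBefore-north a b lt le = trans (cong (λ t → rightOfY ++ (rows (suc a) t ++ segment (rowFn a) a 0 b)) (∸-suc (suc a) r lt))
    (trans (cong (λ t → rightOfY ++ ((rows (suc (suc a)) (r ∸ suc (suc a)) ++ t) ++ segment (rowFn a) a 0 b)) (rowLetters-split (suc a) b le))
      (++-regroup rightOfY (rows (suc (suc a)) (r ∸ suc (suc a))) _ _ _))

  count-readBefore-east : ∀ n a b → count n (readBefore a (suc b)) ≡ count n (readBefore a b) + count n (letterAt (a , b) (rowFn a b))
  count-readBefore-east n a b = trans (cong (count n) wordEq) (count-++ n (readBefore a b) _)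
    where
      wordEq : readBefore a (suc b) ≡ readBefore a b ++ letterAt (a , b) (rowFn a b)
      wordEq = trans (cong (λ t → rightOfY ++ (rows (suc a) (r ∸ suc a) ++ t)) (segment-snoc (rowFn a) a b))
        (trans (cong (rightOfY ++_) (sym (++-assoc (rows (suc a) (r ∸ suc a)) _ _))) (sym (++-assoc rightOfY _ _)))

  -- No j lies in row a + 1 right of column b if row a is > j' right of b,
  -- since j's are column-strict.
  noJsBelowRight : ∀ a b {x} → entryAt T (a , b) ≡ just x →
    (∀ k x' → suc b ≤ k → entryAt T (a , k) ≡ just x' → rank (pr j) < rank x') → jsBelowRight a b ≡ 0
  noJsBelowRight a b {x} h above = count-segment-none j (rowFn (suc a)) (suc a) (suc b) (rowEnd (suc a) ∸ suc b) noJ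
    where
      noJ : ∀ k → suc b ≤ k → k < suc b + (rowEnd (suc a) ∸ suc b) → rowFn (suc a) k ≢ just (un j)
      noJ k le _ e with boxAbove a b k (≤-trans (n≤1+n b) le) (x , h) (un j , e)
      ... | z , hz = <-irrefl refl (≤-<-trans (above k z le hz)
          (rank-< z (un j) (colWeak a k z (un j) hz e) (λ q → colUnprimed a (suc a) k j (n<1+n a) (subst (λ t → entryAt T (a , k) ≡ just t) q hz) e)))

  rightOf-j' : ∀ a b → entryAt T (a , b) ≡ just (pr j) → ∀ k x' → suc b ≤ k → entryAt T (a , k) ≡ just x' → rank (pr j) < rank x'
  rightOf-j' a b h k x' le h' = rank-< (pr j) x' (rowMono a b k (≤-trans (n≤1+n b) le) h h')
    (λ q → rowPrimed a b k j le h (subst (λ t → entryAt T (a , k) ≡ just t) (sym q) h'))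

  rank-≤-j' : ∀ x → x ≡ un i ⊎ x ≡ pr j → rank x ≤ suc Ri
  rank-≤-j' _ (inj₁ refl) = n≤1+n Ri
  rank-≤-j' _ (inj₂ refl) = ≤-reflexive (rank-j' i)

  js≤is : ∀ δ a b → Invariant δ a b → jsBelowRight a b ≡ 0 → count j (readBefore a b) + δ ≤ count i (readBefore a b)
  js≤is δ a b inv none = +-cancelʳ-≤ c _ _ (begin
    js + δ + c    ≡⟨ +-swapʳ js δ c ⟩
    js + c + δ    ≤⟨ +-monoˡ-≤ δ (subst (λ t → js + c ≤ b + t) none fewJs) ⟩
    b + 0 + δ    ≡⟨ cong (_+ δ) (+-identityʳ b) ⟩
    b + δ        ≤⟨ manyIs ⟩
    count i (readBefore a b) + c ∎)
    where
      open ≤-Reasoning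
      js = count j (readBefore a b)
      open Invariant inv

  -- The ribbon cannot stop at an i: the i's would outnumber the j's.
  notEndAtI : ∀ δ a b → a < r → entryAt T (a , b) ≡ just (un i) → inIJ' i (entryAt T (a , suc b)) ≡ false →
    Invariant δ a b → ⊥
  notEndAtI δ a b ar h eastOut inv = after-balanced (readBefore a (suc b)) _ afterEq tooManyIs
    where
      eastAbove : ∀ k x' → suc b ≤ k → entryAt T (a , k) ≡ just x' → rank (pr j) < rank x'
      eastAbove k x' le h' with rowBetween a b k (suc b) (n≤1+n b) le (un i , h) (x' , h')
      ... | e , he with inIJ'-false i e (trans (cong (inIJ' i) (sym he)) eastOut)
      ...   | e≢i , e≢j' = <-≤-trans (rank-< (pr j) e (subst (_≤ rank e) (sym (rank-j' i)) (rank-< (un i) e (rowWeak a b (un i) e h he) (e≢i ∘ sym))) (e≢j' ∘ sym))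
                             (rowMono a (suc b) k le he h')
      inRow = box-rowEnd a b h
      afterEq : after ≡ readBefore a (suc b) ++ (segment (rowFn a) a (suc b) (rowEnd a ∸ suc b) ++ rows 0 a)
      afterEq = after-split a (suc b) ar (proj₁ inRow)
      tooManyIs : count j (readBefore a (suc b)) < count i (readBefore a (suc b))
      tooManyIs rewrite count-readBefore-east j a b | count-readBefore-east i a b | h | count-letterAt-same i (a , b)
                      | count-letterAt-other j (a , b) (just (un i)) (1+n≢n ∘ sym ∘ cong (λ { (just (un t)) → t ; _ → 0 })) =
        subst₂ _<_ (sym (+-identityʳ _)) (+-comm 1 _) (s≤s (≤-trans (m≤m+n _ δ) (js≤is δ a b inv (noJsBelowRight a b h eastAbove))))

  -- At a j' with positive slack the i's would outnumber the j's.
  slackZeroAtJ' : ∀ δ a b → a < r → entryAt T (a , b) ≡ just (pr j) → Invariant δ a b → δ ≡ 0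
  slackZeroAtJ' zero a b ar h inv = refl
  slackZeroAtJ' (suc d) a b ar h inv = ⊥-elim (after-balanced (readBefore a b) _
    (after-split a b ar (<⇒≤ (proj₁ (box-rowEnd a b h))))
    (<-≤-trans (subst (_< count j (readBefore a b) + suc d) (+-identityʳ _) (+-monoʳ-< _ (s≤s z≤n)))
      (js≤is (suc d) a b inv (noJsBelowRight a b h (rightOf-j' a b h)))))

  invariant-north : ∀ δ a b z → suc a < r → entryAt T (suc a , b) ≡ just (pr j) → entryAt T (a , b) ≡ just z →
    z ≡ un i ⊎ z ≡ pr j → Invariant δ (suc a) b → Invariant δ a b
  invariant-north δ a b z ar h hz zIn inv = record
    { manyIs = ≤-trans manyIs (+-monoˡ-≤ c (subst (count i (readBefore (suc a) b) ≤_) (sym (countSplit i)) (m≤m+n _ _)))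
    ; fewJs = begin
        count j (readBefore a b) + c                                     ≡⟨ cong (_+ c) (countSplit j) ⟩
        count j (readBefore (suc a) b) + count j between + c             ≡⟨ cong (λ t → count j (readBefore (suc a) b) + t + c) jsBetween ⟩
        count j (readBefore (suc a) b) + jsBelowRight a b + c            ≡⟨ +-swapʳ (count j (readBefore (suc a) b)) (jsBelowRight a b) c ⟩
        count j (readBefore (suc a) b) + c + jsBelowRight a b            ≤⟨ +-monoˡ-≤ (jsBelowRight a b) belowJ' ⟩
        b + jsBelowRight a b                                             ∎
    }
    where
      open ≤-Reasoning
      open Invariant inv
      inRow = box-rowEnd (suc a) b h
      rowBelowFromB = segment (rowFn (suc a)) (suc a) b (rowEnd (suc a) ∸ b)
      rowLeftOfB = segment (rowFn a) a 0 b
      between = rowBelowFromB ++ rowLeftOfB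
      countSplit : ∀ n → count n (readBefore a b) ≡ count n (readBefore (suc a) b) + count n between
      countSplit n = trans (cong (count n) (readBefore-north a b ar (<⇒≤ (proj₁ inRow)))) (count-++ n (readBefore (suc a) b) between)
      -- left of the ribbon box (a , b) the entries are ≤ j', so no j
      noJLeft : count j rowLeftOfB ≡ 0
      noJLeft = count-segment-none j (rowFn a) a 0 b (λ k _ lt e → 1+n≰n (≤-trans (≤-reflexive (sym (rank-j i)))
                  (≤-trans (rowMono a k b (<⇒≤ lt) e hz) (rank-≤-j' z zIn))))
      -- from (a + 1 , b) on, row a + 1 starts with the j' and continues with the j's counted by jsBelowRight
      jsBetween : count j between ≡ jsBelowRight a b
      jsBetween = begin-equality
        count j between                                           ≡⟨ count-++ j rowBelowFromB rowLeftOfB ⟩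
        count j rowBelowFromB + count j rowLeftOfB                 ≡⟨ cong (count j rowBelowFromB +_) noJLeft ⟩
        count j rowBelowFromB + 0                                  ≡⟨ +-identityʳ _ ⟩
        count j rowBelowFromB                                      ≡⟨ cong (count j) (segment-uncons (rowFn (suc a)) (suc a) b (rowEnd (suc a)) (proj₁ inRow)) ⟩
        count j (letterAt (suc a , b) (rowFn (suc a) b) ++ _)      ≡⟨ count-++ j (letterAt (suc a , b) (rowFn (suc a) b)) _ ⟩
        count j (letterAt (suc a , b) (rowFn (suc a) b)) + jsBelowRight a b ≡⟨ cong (λ t → count j (letterAt (suc a , b) t) + jsBelowRight a b) h ⟩
        jsBelowRight a b                                           ∎
      -- right of the j' at (a + 1 , b) row a + 2 holds no j
      belowJ' : count j (readBefore (suc a) b) + c ≤ b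
      belowJ' = subst (count j (readBefore (suc a) b) + c ≤_) (+-identityʳ b)
                  (subst (λ t → count j (readBefore (suc a) b) + c ≤ b + t) (noJsBelowRight (suc a) b h (rightOf-j' (suc a) b h)) fewJs)

  invariant-east : ∀ δ a b → entryAt T (a , b) ≡ just (un i) → Invariant δ a b → Invariant δ a (suc b)
  invariant-east δ a b h inv = record
    { manyIs = subst (λ t → suc b + δ ≤ t + c) (sym countI) (s≤s manyIs)
    ; fewJs = begin
        count j (readBefore a (suc b)) + c    ≡⟨ cong (_+ c) countJ ⟩
        count j (readBefore a b) + c          ≤⟨ fewJs ⟩
        b + jsBelowRight a b                  ≤⟨ +-monoʳ-≤ b (count-segment-tail j (rowFn (suc a)) (suc a) (suc b) (rowEnd (suc a))) ⟩
        b + suc (jsBelowRight a (suc b))      ≡⟨ +-suc b _ ⟩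
        suc b + jsBelowRight a (suc b)        ∎
    }
    where
      open ≤-Reasoning
      open Invariant inv
      countI : count i (readBefore a (suc b)) ≡ suc (count i (readBefore a b))
      countI = trans (count-readBefore-east i a b)
        (trans (cong (λ t → count i (readBefore a b) + count i (letterAt (a , b) t)) h)
          (trans (cong (count i (readBefore a b) +_) (count-letterAt-same i (a , b))) (+-comm _ 1)))
      countJ : count j (readBefore a (suc b)) ≡ count j (readBefore a b)
      countJ = trans (count-readBefore-east j a b)
        (trans (cong (λ t → count j (readBefore a b) + count j (letterAt (a , b) t)) h)
          (trans (cong (count j (readBefore a b) +_) (count-letterAt-other j (a , b) (just (un i)) (1+n≢n ∘ sym ∘ cong (λ { (just (un t)) → t ; _ → 0 }))))
            (+-identityʳ _)))

  eastStep : ℕ → Pos → Pos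
  eastStep n q = if inIJ' i (entryAt T (eastOf q)) then ribbonEnd i T n (eastOf q) else q

  walk : ∀ δ n a b x → a < r → entryAt T (a , b) ≡ just x → x ≡ un i ⊎ x ≡ pr j →
    potential a b ≤ n → Invariant δ a b → δ ≡ 0 × GoodEnd (ribbonEnd i T n (a , b))
  walkEastFromI : ∀ δ n a b → a < r → entryAt T (a , b) ≡ just (un i) → potential a b ≤ suc n →
    Invariant δ a b → δ ≡ 0 × GoodEnd (eastStep n (a , b))
  walkEastFromJ' : ∀ δ n a b → a < r → entryAt T (a , b) ≡ just (pr j) → AtNorth T (a , b) (λ x → rank x < Ri) →
    Invariant δ a b → δ ≡ 0 × GoodEnd (eastStep n (a , b))

  walk δ zero a b x ar h xIn fuel inv = ⊥-elim (n≮0 (subst (_≤ 0) (potential-east a b h) fuel))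
  walk δ (suc n) zero b _ ar h (inj₁ refl) fuel inv = walkEastFromI δ n zero b ar h fuel inv
  walk δ (suc n) (suc a) b _ ar h (inj₁ refl) fuel inv with inIJ' i (entryAt T (a , b)) in northIn
  ... | true with inIJ'-true i (entryAt T (a , b)) northIn
  ...   | _ , hz , inj₁ refl = ⊥-elim (colUnprimed a (suc a) b i (n<1+n a) hz h)
  ...   | _ , hz , inj₂ refl = ⊥-elim (1+n≰n (subst (_≤ Ri) (rank-j' i) (colWeak a b (pr j) (un i) hz h)))
  walk δ (suc n) (suc a) b _ ar h (inj₁ refl) fuel inv | false = walkEastFromI δ n (suc a) b ar h fuel inv
  walk δ (suc n) zero b _ ar h (inj₂ refl) fuel inv = walkEastFromJ' δ n zero b ar h (λ _ _ ()) inv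
  walk δ (suc n) (suc a) b _ ar h (inj₂ refl) fuel inv with inIJ' i (entryAt T (a , b)) in northIn
  ... | true with inIJ'-true i (entryAt T (a , b)) northIn
  ...   | z , hz , zIn = walk δ n a b z (<-trans (n<1+n a) ar) hz zIn
                           (≤-pred (<-≤-trans (potential-north a b h hz) fuel)) (invariant-north δ a b z ar h hz zIn inv)
  walk δ (suc n) (suc a) b _ ar h (inj₂ refl) fuel inv | false = walkEastFromJ' δ n (suc a) b ar h northBelowI inv
    where
      northBelowI : AtNorth T (suc a , b) (λ x → rank x < Ri)
      northBelowI _ x refl hx with inIJ'-false i x (trans (cong (inIJ' i) (sym hx)) northIn)
      ... | x≢i , x≢j' = rank-< x (un i) (≤-pred (subst (rank x <_) (rank-j' i) (rank-< x (pr j) (colWeak a b x (pr j) hx h) x≢j'))) x≢i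

  walkEastFromI δ n a b ar h fuel inv with inIJ' i (entryAt T (a , suc b)) in eastIn
  ... | false = ⊥-elim (notEndAtI δ a b ar h eastIn inv)
  ... | true with inIJ'-true i (entryAt T (a , suc b)) eastIn
  ...   | z , hz , zIn = walk δ n a (suc b) z ar hz zIn (≤-pred (subst (_≤ suc n) (potential-east a b h) fuel)) (invariant-east δ a b h inv)

  walkEastFromJ' δ n a b ar h northBelowI inv with inIJ' i (entryAt T (a , suc b)) in eastIn
  ... | true with inIJ'-true i (entryAt T (a , suc b)) eastIn
  ...   | _ , hz , inj₁ refl = ⊥-elim (1+n≰n (subst (_≤ Ri) (rank-j' i) (rowWeak a b (pr j) (un i) h hz)))
  ...   | _ , hz , inj₂ refl = ⊥-elim (rowPrimed a b (suc b) j (n<1+n b) h hz)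
  walkEastFromJ' δ n a b ar h northBelowI inv | false = slackZeroAtJ' δ a b ar h inv , h , ar , northBelowI

module RibbonFromNorth (T : Tableau) (P : IsPrimedTableau T) (i r₀ c : ℕ) (rest : List Pos)
                       (hU : unbracketedJ i T ≡ (suc r₀ , c) ∷ rest) where
  open Geometry T P
  open ReadingWord T
  open Potential T
  open Ribbon T P i (suc r₀) c rest hU

  readBefore-start : ∀ n → count n (readBefore r₀ c) ≡ count n rightOfY + count n (segment (rowFn r₀) r₀ 0 c)
  readBefore-start n rewrite count-++ n rightOfY (rows (suc r₀) (suc r₀ ∸ suc r₀) ++ segment (rowFn r₀) r₀ 0 c)
                           | count-++ n (rows (suc r₀) (suc r₀ ∸ suc r₀)) (segment (rowFn r₀) r₀ 0 c)
                           | n∸n≡0 r₀ = refl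

  ribbonFromNorth : ∀ δ z → entryAt T (r₀ , c) ≡ just z → z ≡ un i ⊎ z ≡ pr j → c + δ ≤ count i (readBefore r₀ c) + c →
    δ ≡ 0 × GoodEnd (ribbonEnd i T (size T) (r₀ , c))
  ribbonFromNorth δ z hz zIn manyIs = walk δ (size T) r₀ c z (n<1+n r₀) hz zIn (potential-≤-size r₀ c hz)
    record { manyIs = manyIs ; fewJs = fewJs }
    where
      noJLeft : count j (segment (rowFn r₀) r₀ 0 c) ≡ 0
      noJLeft = count-segment-none j (rowFn r₀) r₀ 0 c (λ k _ lt e → 1+n≰n (≤-trans (≤-reflexive (sym (rank-j i)))
                  (≤-trans (rowMono r₀ k c (<⇒≤ lt) e hz) (rank-≤-j' z zIn))))
      fewJs : count j (readBefore r₀ c) + c ≤ c + jsBelowRight r₀ c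
      fewJs rewrite readBefore-start j | noJLeft | +-identityʳ (count j rightOfY) = ≤-reflexive (+-comm (count j rightOfY) c)

module Updates (X : Tableau) (PX : IsPrimedTableau X) (i : ℕ) (1≤i : 1 ≤ i) where
  open IsPrimedTableau PX
  open Geometry X PX

  j : ℕ
  j = suc i

  Ri : ℕ
  Ri = rank (un i)

  noOtherIInColumn : ∀ r c e → entryAt X (r , c) ≡ just e → Ri < rank e → AtNorth X (r , c) (λ x → rank x < Ri) →
    ∀ r' → r' ≢ r → entryAt X (r' , c) ≢ just (un i)
  noOtherIInColumn r c e h lt northBelow r' ne h' with <-cmp r' r
  ... | tri≈ _ eq _ = ne eq
  ... | tri> _ _ gt = <-irrefl refl (<-≤-trans lt (colMono r r' c (<⇒≤ gt) h h'))
  noOtherIInColumn (suc r₀) c e h lt northBelow r' ne h' | tri< lt' _ _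
    with colBetween r' (suc r₀) r₀ c (≤-pred lt') (n≤1+n r₀) (un i , h') (e , h)
  ... | x , hx = 1+n≰n (≤-trans (northBelow r₀ x refl hx) (colMono r' r₀ c (≤-pred lt') h' hx))

  noJ'InRowOfJ : ∀ r c → entryAt X (r , c) ≡ just (un j) → AtWest X (r , c) (λ x → rank x ≤ Ri) →
    ∀ c' → c' ≢ c → entryAt X (r , c') ≢ just (pr j)
  noJ'InRowOfJ r c h westBelow c' ne h' with <-cmp c' c
  ... | tri≈ _ eq _ = ne eq
  ... | tri> _ _ gt = 1+n≰n (rowMono r c c' (<⇒≤ gt) h h')
  noJ'InRowOfJ r (suc c₀) h westBelow c' ne h' | tri< lt' _ _
    with rowBetween r c' (suc c₀) c₀ (≤-pred lt') (n≤1+n c₀) (pr j , h') (un j , h)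
  ... | x , hx = 1+n≰n (≤-trans (≤-reflexive (sym (rank-j' i))) (≤-trans (rowMono r c' c₀ (≤-pred lt') h' hx) (westBelow c₀ x refl hx)))

  rank-i≤j : Ri ≤ rank (un j)
  rank-i≤j = ≤-trans (n≤1+n Ri) (≤-trans (n≤1+n _) (≤-reflexive (sym (rank-j i))))

  j'→i-primed : ∀ r c → entryAt X (r , c) ≡ just (pr j) → AtNorth X (r , c) (λ x → rank x < Ri) →
    IsPrimedTableau (setAt (r , c) (un i) X)
  j'→i-primed r c h northBelow = setAt-primed X r c (un i) PX h record
    { positive = 1≤i
    ; westBelow = λ { c₀ x refl hx → ≤-pred (subst (rank x <_) (rank-j' i) (rank-< x (pr j) (rowWeak r c₀ x (pr j) hx h)
                        (λ q → rowPrimed r c₀ (suc c₀) j (n<1+n c₀) (subst (λ t → entryAt X (r , c₀) ≡ just t) q hx) h))) }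
    ; eastAbove = λ x hx → ≤-trans (n≤1+n Ri) (subst (_≤ rank x) (rank-j' i) (rowWeak r c (pr j) x h hx))
    ; northBelow = λ r₀ x e hx → <⇒≤ (northBelow r₀ x e hx)
    ; southAbove = λ x hx → ≤-trans (n≤1+n Ri) (subst (_≤ rank x) (rank-j' i) (colWeak r c (pr j) x h hx))
    ; primedAlone = λ k ()
    ; unprimedAlone = λ { k refl → noOtherIInColumn r c (pr j) h (subst (Ri <_) (sym (rank-j' i)) ≤-refl) northBelow }
    }

  j→j'-primed : ∀ r c → entryAt X (r , c) ≡ just (un j) → AtWest X (r , c) (λ x → rank x ≤ Ri) →
    AtNorth X (r , c) (λ x → rank x ≤ rank (pr j)) → IsPrimedTableau (setAt (r , c) (pr j) X)
  j→j'-primed r c h westBelow northBelow = setAt-primed X r c (pr j) PX h record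
    { positive = s≤s z≤n
    ; westBelow = λ c₀ x e hx → ≤-trans (westBelow c₀ x e hx) (≤-trans (n≤1+n Ri) (≤-reflexive (sym (rank-j' i))))
    ; eastAbove = λ x hx → ≤-trans (n≤1+n _) (rowWeak r c (un j) x h hx)
    ; northBelow = northBelow
    ; southAbove = λ x hx → ≤-trans (n≤1+n _) (colWeak r c (un j) x h hx)
    ; primedAlone = λ { k refl → noJ'InRowOfJ r c h westBelow }
    ; unprimedAlone = λ k ()
    }

  j→i-primed : ∀ r c → entryAt X (r , c) ≡ just (un j) → AtWest X (r , c) (λ x → rank x ≤ Ri) →
    AtNorth X (r , c) (λ x → rank x < Ri) → IsPrimedTableau (setAt (r , c) (un i) X)
  j→i-primed r c h westBelow northBelow = setAt-primed X r c (un i) PX h record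
    { positive = 1≤i
    ; westBelow = westBelow
    ; eastAbove = λ x hx → ≤-trans rank-i≤j (rowWeak r c (un j) x h hx)
    ; northBelow = λ r₀ x e hx → <⇒≤ (northBelow r₀ x e hx)
    ; southAbove = λ x hx → ≤-trans rank-i≤j (colWeak r c (un j) x h hx)
    ; primedAlone = λ k ()
    ; unprimedAlone = λ { k refl → noOtherIInColumn r c (un j) h (subst (Ri <_) (sym (rank-j i)) (<-trans (n<1+n _) (n<1+n _))) northBelow }
    }

eOp-result : ∀ i T y p → leftmostUnbracketedJ i T ≡ just y → choiceP i T y ≡ just p →
  eOp i T ≡ tabE (modifyAt p halfDown (modifyAt y halfDown T))
eOp-result i T y p e₁ e₂ with leftmostUnbracketedJ i T | e₁
... | just .y | refl with choiceP i T y | e₂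
...   | just .p | refl = refl

choice-case1 : ∀ i T y → leM (entryAtM T (westOf y)) (un i) ≡ true → ltM (entryAtM T (northOf y)) (un i) ≡ true →
  choiceP i T y ≡ just y
choice-case1 i T y e₁ e₂ rewrite e₁ | e₂ = refl

choice-case2 : ∀ i T y → leM (entryAtM T (westOf y)) (un i) ≡ false → eqM (entryAtM T (westOf y)) (pr (suc i)) ≡ true →
  choiceP i T y ≡ westOf y
choice-case2 i T y e₁ e₂ rewrite e₁ | e₂ = refl

choice-case3 : ∀ i T r₀ c → leM (entryAtM T (westOf (suc r₀ , c))) (un i) ≡ true → ltM (entryAt T (r₀ , c)) (un i) ≡ false →
  eqM (entryAtM T (westOf (suc r₀ , c))) (pr (suc i)) ≡ false → inIJ' i (entryAt T (r₀ , c)) ≡ true →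
  choiceP i T (suc r₀ , c) ≡ just (ribbonEnd i T (size T) (r₀ , c))
choice-case3 i T r₀ c e₁ e₂ e₃ e₄ rewrite e₁ | e₂ | e₃ | e₄ = refl

west-≤-test : ∀ T i y → AtWest T y (λ x → rank x ≤ rank (un i)) → leM (entryAtM T (westOf y)) (un i) ≡ true
west-≤-test T i (r , zero) h = refl
west-≤-test T i (r , suc c) h with entryAt T (r , c) in e
... | nothing = refl
... | just x = Equivalence.to T-≡ (≤⇒≤ᵇ (h c x refl e))

west-j'-test : ∀ T i y → AtWest T y (λ x → rank x ≤ rank (un i)) → eqM (entryAtM T (westOf y)) (pr (suc i)) ≡ false
west-j'-test T i (r , zero) h = refl
west-j'-test T i (r , suc c) h with entryAt T (r , c) in e
... | nothing = refl
... | just x = ¬-not (λ q → 1+n≰n (subst (_≤ rank (un i)) (trans (cong rank (eqE-sound x (pr (suc i)) q)) (rank-j' i)) (h c x refl e)))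

north-<-test : ∀ T i y → AtNorth T y (λ x → rank x < rank (un i)) → ltM (entryAtM T (northOf y)) (un i) ≡ true
north-<-test T i (zero , c) h = refl
north-<-test T i (suc r , c) h with entryAt T (r , c) in e
... | nothing = refl
... | just x = Equivalence.to T-≡ (<⇒<ᵇ (h r x refl e))

Conclusion : Tableau → ℕ → Set
Conclusion T i = Σ Pos (λ y → Σ Pos (λ p →
      leftmostUnbracketedJ i T ≡ just y × choiceP i T y ≡ just p ×
      entryAt T y ≡ just (un (suc i)) ×
      ((p ≡ y × eOp i T ≡ tabE (setAt y (un i) T))
       ⊎ (p ≢ y × entryAt T p ≡ just (pr (suc i)) ×
          eOp i T ≡ tabE (setAt p (un i) (setAt y (pr (suc i)) T)))) ×
      Σ Tableau (λ U → eOp i T ≡ tabE U × IsPrimedTableau U)))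

-- Case p = y: decreasing y twice turns j into i.
conclude-same : ∀ T i y → leftmostUnbracketedJ i T ≡ just y → choiceP i T y ≡ just y → entryAt T y ≡ just (un (suc i)) →
  IsPrimedTableau (setAt y (un i) T) → Conclusion T i
conclude-same T i y eL ch hy primed = y , y , eL , ch , hy , inj₁ (refl , eop) , _ , eop , primed
  where
    eop : eOp i T ≡ tabE (setAt y (un i) T)
    eop = trans (eOp-result i T y y eL ch) (cong tabE (modifyAt-twice T y halfDown halfDown (λ _ → un i) hy refl))

-- Case p ≠ y: y turns from j into j' and p from j' into i; the two changes commute.
conclude-moved : ∀ T i y p → p ≢ y → leftmostUnbracketedJ i T ≡ just y → choiceP i T y ≡ just p →
  entryAt T y ≡ just (un (suc i)) → entryAt T p ≡ just (pr (suc i)) →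
  IsPrimedTableau (setAt y (pr (suc i)) (setAt p (un i) T)) → Conclusion T i
conclude-moved T i y p p≢y eL ch hy hp primed = y , p , eL , ch , hy , inj₂ (p≢y , hp , eop) , _ , eop ,
    subst IsPrimedTableau (modifyAt-commute T y p (λ _ → pr (suc i)) (λ _ → un i) (p≢y ∘ sym)) primed
  where
    eop : eOp i T ≡ tabE (setAt p (un i) (setAt y (pr (suc i)) T))
    eop = trans (eOp-result i T y p eL ch) (cong tabE (trans (cong (modifyAt p halfDown) (modifyAt-cong T y hy refl))
            (modifyAt-cong (setAt y (pr (suc i)) T) p (trans (entryAt-set-elsewhere T y (pr (suc i)) p p≢y) hp) refl)))

eOp-zero : ∀ i T → leftmostUnbracketedJ i T ≡ nothing → eOp i T ≡ zeroE
eOp-zero i T e with leftmostUnbracketedJ i T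
... | nothing = refl

module Cases (T : Tableau) (P : IsPrimedTableau T) (i : ℕ) (1≤i : 1 ≤ i) where
  open IsPrimedTableau P
  open Geometry T P
  open Updates T P i 1≤i using (j; Ri; j'→i-primed; j→j'-primed; j→i-primed)

  -- The North neighbour of a j is ≤ j' (unprimed j's are column-strict).
  northOfJ : ∀ r c → entryAt T (r , c) ≡ just (un j) → AtNorth T (r , c) (λ x → rank x ≤ rank (pr j))
  northOfJ _ c hy r₀ x refl hx = ≤-pred (rank-< x (un j) (colWeak r₀ c x (un j) hx hy)
    (λ q → colUnprimed r₀ (suc r₀) c j (n<1+n r₀) (subst (λ t → entryAt T (r₀ , c) ≡ just t) q hx) hy))

  westCases : ∀ r c rest → unbracketedJ i T ≡ (r , c) ∷ rest →
    AtWest T (r , c) (λ x → rank x ≤ Ri) ⊎ Σ ℕ (λ c' → c ≡ suc c' × entryAt T (r , c') ≡ just (pr j))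
  westCases r zero rest hU = inj₁ (λ _ _ ())
  westCases r (suc c') rest hU with entryAt T (r , c') in hW
  ... | nothing = inj₁ λ { _ _ refl hx → ⊥-elim (absent (trans (sym hW) hx)) }
    where
      absent : ∀ {x} → nothing ≡ just x → ⊥
      absent ()
  ... | just x with m≤n⇒m<n∨m≡n (≤-pred (rank-< x (un j) (rowWeak r c' x (un j) hW (LeftmostJ.y-holds-j T i r (suc c') rest hU))
                      (λ q → LeftmostJ.west-not-j T i r (suc c') rest hU c' refl (subst (λ t → entryAt T (r , c') ≡ just t) q hW))))
  ...   | inj₁ lt = inj₁ λ { _ x' refl hx' → subst (λ t → rank t ≤ Ri) (just-injective (trans (sym hW) hx')) (≤-pred (subst (rank x <_) (rank-j' i) lt)) }
  ...   | inj₂ eq = inj₂ (c' , refl , trans hW (cong just (rank-injective x (pr j) eq)))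

  northCases : ∀ r c → entryAt T (r , c) ≡ just (un j) →
    AtNorth T (r , c) (λ x → rank x < Ri) ⊎
    Σ ℕ (λ r₀ → r ≡ suc r₀ × Σ Entry (λ z → entryAt T (r₀ , c) ≡ just z × (z ≡ un i ⊎ z ≡ pr j)))
  northCases zero c hy = inj₁ (λ _ _ ())
  northCases (suc r₀) c hy with entryAt T (r₀ , c) in hN
  ... | nothing = inj₁ λ { _ _ refl hx → ⊥-elim (absent (trans (sym hN) hx)) }
    where
      absent : ∀ {x} → nothing ≡ just x → ⊥
      absent ()
  ... | just z with rank z <? Ri
  ...   | yes lt = inj₁ λ { _ x refl hx → subst (λ t → rank t < Ri) (just-injective (trans (sym hN) hx)) lt }
  ...   | no ≮ = inj₂ (r₀ , refl , z , hN ,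
                      between-i-j' i z (≮⇒≥ ≮) (subst (rank z ≤_) (rank-j' i) (northOfJ (suc r₀) c hy r₀ z refl hN)))

  case1 : ∀ r c → leftmostUnbracketedJ i T ≡ just (r , c) → entryAt T (r , c) ≡ just (un j) →
    AtWest T (r , c) (λ x → rank x ≤ Ri) → AtNorth T (r , c) (λ x → rank x < Ri) → Conclusion T i
  case1 r c eL hy west north = conclude-same T i (r , c) eL
    (choice-case1 i T (r , c) (west-≤-test T i (r , c) west) (north-<-test T i (r , c) north)) hy
    (j→i-primed r c hy west north)

  -- It is ≤ j' = c(W_y); it is
  -- not j', since then N_y would be a second j' in its row; and it is not i,
  -- since then N_y ∈ {i, j'} and the ribbon from N_y would start with one
  -- i too many.
  northOfWestJ' : ∀ r c' rest → unbracketedJ i T ≡ (r , suc c') ∷ rest → entryAt T (r , c') ≡ just (pr j) →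
    AtNorth T (r , c') (λ x → rank x < Ri)
  northOfWestJ' _ c' rest hU hW r₀ x refl hx = rank-< x (un i) (≤-pred (subst (rank x <_) (rank-j' i) x<j')) x≢i
    where
      open LeftmostJ T i (suc r₀) (suc c') rest hU using (y-holds-j)
      open Ribbon T P i (suc r₀) (suc c') rest hU using (rightOfY; readBefore)
      open RibbonFromNorth T P i r₀ (suc c') rest hU using (ribbonFromNorth; readBefore-start)
      northOfY = boxAbove r₀ c' (suc c') (n≤1+n c') (x , hx) (un j , y-holds-j)
      n = proj₁ northOfY
      hn = proj₂ northOfY
      n≤j' : rank n ≤ rank (pr j)
      n≤j' = northOfJ (suc r₀) (suc c') y-holds-j r₀ n refl hn
      x≢j' : x ≢ pr j
      x≢j' refl = rowPrimed r₀ c' (suc c') j (n<1+n c') hx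
        (subst (λ t → entryAt T (r₀ , suc c') ≡ just t) (rank-injective n (pr j) (≤-antisym n≤j' (rowWeak r₀ c' (pr j) n hx hn))) hn)
      x<j' : rank x < rank (pr j)
      x<j' = rank-< x (pr j) (colWeak r₀ c' x (pr j) hx hW) x≢j'
      x≢i : x ≢ un i
      x≢i refl with ribbonFromNorth 1 n hn (between-i-j' i n (rowWeak r₀ c' (un i) n hx hn) (subst (rank n ≤_) (rank-j' i) n≤j')) oneIMore
        where
          iLeftOfN : 1 ≤ count i (segment (ReadingWord.rowFn T r₀) r₀ 0 (suc c'))
          iLeftOfN rewrite segment-snoc (ReadingWord.rowFn T r₀) r₀ c' | count-++ i (segment (ReadingWord.rowFn T r₀) r₀ 0 c') (letterAt (r₀ , c') (ReadingWord.rowFn T r₀ c'))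
                         | hx | count-letterAt-same i (r₀ , c') = m≤n+m 1 _
          oneIMore : suc c' + 1 ≤ count i (readBefore r₀ (suc c')) + suc c'
          oneIMore rewrite readBefore-start i | +-comm (suc c') 1 = +-monoˡ-≤ (suc c') (≤-trans iLeftOfN (m≤n+m _ (count i rightOfY)))
      ... | () , _

  case2 : ∀ r c' rest → unbracketedJ i T ≡ (r , suc c') ∷ rest → leftmostUnbracketedJ i T ≡ just (r , suc c') →
    entryAt T (r , c') ≡ just (pr j) → Conclusion T i
  case2 r c' rest hU eL hW = conclude-moved T i (r , suc c') (r , c') p≢y eL choice y-holds-j hW primed
    where
      open LeftmostJ T i r (suc c') rest hU using (y-holds-j)
      p≢y : (r , c') ≢ (r , suc c')
      p≢y = 1+n≢n ∘ sym ∘ cong proj₂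
      westNotLe : leM (entryAtM T (westOf (r , suc c'))) (un i) ≡ false
      westNotLe rewrite hW = ¬-not (λ e → 1+n≰n (subst (_≤ Ri) (rank-j' i) (≤ᵇ⇒≤ _ _ (Equivalence.from T-≡ e))))
      westIsJ' : eqM (entryAtM T (westOf (r , suc c'))) (pr j) ≡ true
      westIsJ' rewrite hW = eqE-refl (pr j)
      choice : choiceP i T (r , suc c') ≡ just (r , c')
      choice = choice-case2 i T (r , suc c') westNotLe westIsJ'
      -- first W_y becomes i, then y fits as j'
      T₁ = setAt (r , c') (un i) T
      hy₁ : entryAt T₁ (r , suc c') ≡ just (un j)
      hy₁ = trans (entryAt-set-elsewhere T (r , c') (un i) (r , suc c') (p≢y ∘ sym)) y-holds-j
      west₁ : AtWest T₁ (r , suc c') (λ x → rank x ≤ Ri)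
      west₁ _ x refl hx = ≤-reflexive (cong rank (just-injective (trans (sym hx) (entryAt-set-here T (r , c') (un i) hW))))
      north₁ : AtNorth T₁ (r , suc c') (λ x → rank x ≤ rank (pr j))
      north₁ r₁ x e hx = northOfJ r (suc c') y-holds-j r₁ x e
        (trans (sym (entryAt-set-elsewhere T (r , c') (un i) (r₁ , suc c') (1+n≢n ∘ cong proj₂))) hx)
      primed = Updates.j→j'-primed T₁ (j'→i-primed r c' hW (northOfWestJ' r c' rest hU hW)) i 1≤i r (suc c') hy₁ west₁ north₁

  case3 : ∀ r₀ c rest → unbracketedJ i T ≡ (suc r₀ , c) ∷ rest → leftmostUnbracketedJ i T ≡ just (suc r₀ , c) →
    AtWest T (suc r₀ , c) (λ x → rank x ≤ Ri) → ∀ z → entryAt T (r₀ , c) ≡ just z → z ≡ un i ⊎ z ≡ pr j → Conclusion T i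
  case3 r₀ c rest hU eL west z hz zIn = conclude-moved T i (suc r₀ , c) p p≢y eL choice y-holds-j hp primed
    where
      open LeftmostJ T i (suc r₀) c rest hU using (y-holds-j)
      open RibbonFromNorth T P i r₀ c rest hU using (ribbonFromNorth)
      p = ribbonEnd i T (size T) (r₀ , c)
      good = proj₂ (ribbonFromNorth 0 z hz zIn (≤-trans (≤-reflexive (+-identityʳ c)) (m≤n+m c _)))
      hp = proj₁ good
      pAbove = proj₁ (proj₂ good)
      p≢y : p ≢ (suc r₀ , c)
      p≢y q = <-irrefl (cong proj₁ q) pAbove
      i≤z : Ri ≤ rank z
      i≤z = Data.Sum.[ (λ { refl → ≤-refl }) , (λ { refl → ≤-trans (n≤1+n Ri) (≤-reflexive (sym (rank-j' i))) }) ] zIn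
      northNotBelow : ltM (entryAt T (r₀ , c)) (un i) ≡ false
      northNotBelow rewrite hz = ¬-not (λ e → 1+n≰n (≤-trans (<ᵇ⇒< _ _ (Equivalence.from T-≡ e)) i≤z))
      northIn : inIJ' i (entryAt T (r₀ , c)) ≡ true
      northIn rewrite hz = inIJ'-intro i z zIn
      choice : choiceP i T (suc r₀ , c) ≡ just p
      choice = choice-case3 i T r₀ c (west-≤-test T i (suc r₀ , c) west) northNotBelow (west-j'-test T i (suc r₀ , c) west) northIn
      -- first p becomes i, then y fits as j'; the row of y is untouched
      T₁ = setAt p (un i) T
      unchanged : ∀ c' → entryAt T₁ (suc r₀ , c') ≡ entryAt T (suc r₀ , c')
      unchanged c' = entryAt-set-elsewhere T p (un i) (suc r₀ , c') (λ q → <-irrefl (sym (cong proj₁ q)) pAbove)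
      west₁ : AtWest T₁ (suc r₀ , c) (λ x → rank x ≤ Ri)
      west₁ c₀ x e hx = west c₀ x e (trans (sym (unchanged c₀)) hx)
      north₁ : AtNorth T₁ (suc r₀ , c) (λ x → rank x ≤ rank (pr j))
      north₁ r₁ x e hx with (r₁ , c) ≟P p
      ... | yes q = ≤-trans (≤-reflexive (cong rank (just-injective (trans (sym hx) (trans (cong (entryAt T₁) q) (entryAt-set-here T p (un i) hp))))))
                      (≤-trans (n≤1+n Ri) (≤-reflexive (sym (rank-j' i))))
      ... | no ne = northOfJ (suc r₀) c y-holds-j r₁ x e (trans (sym (entryAt-set-elsewhere T p (un i) (r₁ , c) ne)) hx)
      primed = Updates.j→j'-primed T₁ (j'→i-primed (proj₁ p) (proj₂ p) hp (proj₂ (proj₂ good))) i 1≤i (suc r₀) c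
                 (trans (unchanged c) y-holds-j) west₁ north₁

  atLeftmost : ∀ r c rest → unbracketedJ i T ≡ (r , c) ∷ rest → leftmostUnbracketedJ i T ≡ just (r , c) → Conclusion T i
  atLeftmost r c rest hU eL with westCases r c rest hU
  ... | inj₂ (c' , refl , hW) = case2 r c' rest hU eL hW
  ... | inj₁ west with northCases r c (LeftmostJ.y-holds-j T i r c rest hU)
  ...   | inj₁ north = case1 r c eL (LeftmostJ.y-holds-j T i r c rest hU) west north
  ...   | inj₂ (r₀ , refl , z , hz , zIn) = case3 r₀ c rest hU eL west z hz zIn

mainTheorem5 : (T : Tableau) (i : ℕ) → 1 ≤ i → IsPrimedTableau T → eOp i T ≢ zeroE →
    Σ Pos (λ y → Σ Pos (λ p →
      leftmostUnbracketedJ i T ≡ just y × choiceP i T y ≡ just p ×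
      entryAt T y ≡ just (un (suc i)) ×
      ((p ≡ y × eOp i T ≡ tabE (setAt y (un i) T))
       ⊎ (p ≢ y × entryAt T p ≡ just (pr (suc i)) ×
          eOp i T ≡ tabE (setAt p (un i) (setAt y (pr (suc i)) T)))) ×
      Σ Tableau (λ U → eOp i T ≡ tabE U × IsPrimedTableau U)))
mainTheorem5 T i 1≤i P e≢0 = fromLeftmost (leftmostUnbracketedJ i T) refl
  where
    fromLeftmost : ∀ m → leftmostUnbracketedJ i T ≡ m → Conclusion T i
    fromLeftmost nothing eL = ⊥-elim (e≢0 (eOp-zero i T eL))
    fromLeftmost (just (r , c)) eL with leftmost-unbracketed i T eL
    ... | rest , hU = Cases.atLeftmost T P i 1≤i r c rest hU eL
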